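{- Let $R$ be a commutative ring with identity $1\neq 0$ that is not an integral domain (so that $\Gamma(R)$ has at least one vertex). (i) If $R$ is finite and $\Gamma(R)$ is a regular graph of degree $r$, then $\alpha(\Gamma(R))$ is either $1$ or $r$. (ii) If $R$ is finite and decomposable and $\Gamma(R)$ is Hamiltonian, then $\alpha(\Gamma(R))=|Z^*(R)|/2$. (iii) If $R$ is a finite principal ideal ring which is not decomposable and $\Gamma(R)$ is Hamiltonian, then $\alpha(\Gamma(R))=1$.
   Context: $Z(R)$ denotes the set of zero-divisors of $R$ and $Z^*(R)=Z(R)\setminus\{0\}$. The zero-divisor graph $\Gamma(R)$ is the simple undirected graph with vertex set $Z^*(R)$, two distinct vertices $x,y$ adjacent iff $xy=0$. A ring is decomposable if it is isomorphic to a direct product of two nonzero rings. A graph is Hamiltonian if it has a cycle passing through every vertex exactly once. A graph is regular of degree $r$ if every vertex has exactly $r$ neighbours. $\alpha(G)$ denotes the independence number (maximum size of a set of pairwise non-adjacent vertices). -}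

module Defs where

open import Level using (0ℓ)
open import Data.Nat using (ℕ; _≤_)
open import Data.Fin using (Fin)
open import Data.Product using (Σ; ∃; _×_; Σ-syntax)
open import Data.List using (List; []; _∷_; length; _++_; [_])
open import Data.List.Membership.Propositional using (_∈_)
open import Data.List.Relation.Unary.All using (All)
open import Data.List.Relation.Unary.AllPairs using (AllPairs)
open import Data.List.Relation.Unary.Unique.Propositional using (Unique)
open import Data.List.Relation.Unary.Linked using (Linked)
open import Function.Bundles using (_⇔_)
open import Relation.Nullary using (¬_)
open import Relation.Binary.PropositionalEquality using (_≡_; _≢_; isEquivalence)
open import Algebra.Structures using (IsCommutativeRing)
open import Algebra.Bundles using (CommutativeRing; RawRing)
open import Algebra.Morphism.Structures using (IsRingIsomorphism)
import Algebra.Construct.DirectProduct as DP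

-- A finite commutative ring with identity: a commutative ring structure
-- (with propositional equality) on the carrier Fin n.  Every finite
-- commutative ring is isomorphic to one of this form.

record FinCommRing : Set where
  field
    size : ℕ
    _+_  : Fin size → Fin size → Fin size
    _*_  : Fin size → Fin size → Fin size
    -_   : Fin size → Fin size
    0#   : Fin size
    1#   : Fin size
    isCommutativeRing : IsCommutativeRing _≡_ _+_ _*_ -_ 0# 1#

  infixl 6 _+_
  infixl 7 _*_

  Carrier : Set
  Carrier = Fin size

  commutativeRing : CommutativeRing 0ℓ 0ℓ
  commutativeRing = record { isCommutativeRing = isCommutativeRing }

  rawRing : RawRing 0ℓ 0ℓ
  rawRing = CommutativeRing.rawRing commutativeRing

open FinCommRing

HasSize : {n : ℕ} → (Fin n → Set) → ℕ → Set
HasSize {n} P k =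
  Σ[ xs ∈ List (Fin n) ] (Unique xs × (∀ u → (u ∈ xs) ⇔ P u) × length xs ≡ k)

record SubGraph (n : ℕ) : Set₁ where
  field
    Vtx : Fin n → Set
    Adj : Fin n → Fin n → Set         -- adjacency (meaningful on vertices)

open SubGraph public

module _ {n : ℕ} (G : SubGraph n) where

  Nbr : Fin n → Fin n → Set
  Nbr v u = Vtx G u × u ≢ v × Adj G v u

  IsRegular : ℕ → Set
  IsRegular r = ∀ v → Vtx G v → HasSize (Nbr v) r

  IsIndependent : List (Fin n) → Set
  IsIndependent xs = Unique xs × All (Vtx G) xs × AllPairs (λ x y → ¬ Adj G x y) xs

  IndependenceNumberIs : ℕ → Set
  IndependenceNumberIs k =
    (Σ[ xs ∈ List (Fin n) ] (IsIndependent xs × length xs ≡ k))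
    × (∀ xs → IsIndependent xs → length xs ≤ k)

  IsHamiltonian : Set
  IsHamiltonian =
    Σ[ v₀ ∈ Fin n ] Σ[ rest ∈ List (Fin n) ]
      ( Unique (v₀ ∷ rest)
      × (∀ u → (u ∈ v₀ ∷ rest) ⇔ Vtx G u)
      × 3 ≤ length (v₀ ∷ rest)
      × Linked (Adj G) ((v₀ ∷ rest) ++ [ v₀ ]) )

module _ (R : FinCommRing) where

  IsZeroDivisor : Carrier R → Set
  IsZeroDivisor x = Σ[ y ∈ Carrier R ] (y ≢ 0# R × _*_ R x y ≡ 0# R)

  IsZeroDivisorStar : Carrier R → Set
  IsZeroDivisorStar x = IsZeroDivisor x × x ≢ 0# R

  Γ : SubGraph (size R)
  Γ = record
    { Vtx = IsZeroDivisorStar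
    ; Adj = λ x y → x ≢ y × _*_ R x y ≡ 0# R }

  IsIntegralDomain : Set
  IsIntegralDomain =
    (1# R ≢ 0# R) × (∀ x y → _*_ R x y ≡ 0# R → (x ≡ 0# R) Data.Sum.⊎ (y ≡ 0# R))
    where import Data.Sum

  record IsIdeal (I : Carrier R → Set) : Set where
    field
      zero∈ : I (0# R)
      +-closed : ∀ x y → I x → I y → I (_+_ R x y)
      neg-closed : ∀ x → I x → I (-_ R x)
      *-closed : ∀ r x → I x → I (_*_ R r x)

  IsPrincipal : (Carrier R → Set) → Set
  IsPrincipal I = Σ[ a ∈ Carrier R ] (∀ x → I x ⇔ (Σ[ r ∈ Carrier R ] x ≡ _*_ R r a))

  IsPrincipalIdealRing : Set₁
  IsPrincipalIdealRing = ∀ (I : Carrier R → Set) → IsIdeal I → IsPrincipal I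

  IsDecomposable : Set₁
  IsDecomposable =
    Σ[ R₁ ∈ CommutativeRing 0ℓ 0ℓ ] Σ[ R₂ ∈ CommutativeRing 0ℓ 0ℓ ]
      ( ¬ (CommutativeRing._≈_ R₁ (CommutativeRing.1# R₁) (CommutativeRing.0# R₁))
      × ¬ (CommutativeRing._≈_ R₂ (CommutativeRing.1# R₂) (CommutativeRing.0# R₂))
      × Σ[ φ ∈ (Carrier R → CommutativeRing.Carrier (DP.commutativeRing R₁ R₂)) ]
          IsRingIsomorphism (rawRing R)
            (CommutativeRing.rawRing (DP.commutativeRing R₁ R₂)) φ )

-- A nontrivial idempotent e splits R ≅ eR × fR (f = 1 - e).  If neither factor has zero-divisors,
-- Γ(R) is complete bipartite with parts eR ∖ 0 and fR ∖ 0, and α(Γ(R)) is the size of the larger part.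
-- Regularity and Hamiltonicity each exclude zero-divisors in the factors; then the parts are the
-- neighbourhoods of f and e (so both have size r), resp. a Hamiltonian cycle maps each part injectively
-- into the other (so they have equal size).  Without nontrivial idempotents R is local and Z(R) is
-- its nilradical, which has a nonzero annihilator t; t is adjacent to every vertex, so a regular Γ(R)
-- is complete.  If the nilradical is principal, (a), either a² = 0 and Γ(R) is again complete, or
-- the vertices a + ann(a) have too few neighbours for a Hamiltonian cycle.

module Submission where

open import Level using (0ℓ)
open import Data.Nat as ℕ using (ℕ; zero; suc; z≤n; s≤s)
import Data.Nat.Properties as ℕ
open import Data.Nat.Tactic.RingSolver using (solve-∀)
open import Data.Fin using (Fin; toℕ)
open import Data.Fin.Properties using (_≟_; any?; pigeonhole)
open import Data.Product using (_×_; _,_; proj₁; proj₂; Σ-syntax)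
open import Data.Sum using (_⊎_; inj₁; inj₂)
import Data.Sum as Sum
open import Data.Empty using (⊥; ⊥-elim)
open import Data.List using (List; []; _∷_; length; _++_; [_]; filter; allFin; map; cartesianProductWith; initLast; _∷ʳ′_)
open import Data.List.Properties using (length-++; length-map; ++-assoc)
open import Data.List.Membership.Propositional using (_∈_; _∉_)
open import Data.List.Membership.Propositional.Properties
  using (∈-filter⁺; ∈-filter⁻; ∈-allFin; ∈-++⁻; ∈-++⁺ˡ; ∈-++⁺ʳ; ∈-map⁻; ∈-cartesianProductWith⁻; ∈-∃++)
open import Data.List.Relation.Binary.Subset.Propositional using (_⊆_)
open import Data.List.Relation.Unary.Any using (here; there)
open import Data.List.Relation.Unary.All as All using (All; []; _∷_)
import Data.List.Relation.Unary.All.Properties as All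
open import Data.List.Relation.Unary.AllPairs using (AllPairs; []; _∷_)
open import Data.List.Relation.Unary.Unique.Propositional using (Unique)
import Data.List.Relation.Unary.Unique.Propositional.Properties as Unique
open import Data.List.Relation.Unary.Linked using (Linked; []; [-]; _∷_)
open import Function using (_∘_)
open import Function.Bundles using (_⇔_; Equivalence; mk⇔)
open import Relation.Nullary using (¬_; Dec; yes; no)
open import Relation.Nullary.Decidable using (_×-dec_; ¬?; decidable-stable)
open import Relation.Unary using (Pred; Decidable)
open import Relation.Binary.PropositionalEquality as ≡
  using (_≡_; _≢_; refl; sym; trans; cong; cong₂; subst; module ≡-Reasoning)
open import Algebra.Bundles using (CommutativeRing; Semiring)
open import Algebra.Structures using (IsCommutativeRing)
open import Algebra.Morphism.Structures using (IsRingIsomorphism)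
import Algebra.Construct.DirectProduct as DirectProduct

open import Defs

open Equivalence using (to; from)

module _ {A : Set} where

  private
    remove : ∀ {x} (ys : List A) → x ∈ ys → List A
    remove (y ∷ ys) (here _)  = ys
    remove (y ∷ ys) (there p) = y ∷ remove ys p

    length-remove : ∀ {x} (ys : List A) (p : x ∈ ys) → suc (length (remove ys p)) ≡ length ys
    length-remove (y ∷ ys) (here _)  = refl
    length-remove (y ∷ ys) (there p) = cong suc (length-remove ys p)

    ∈-remove : ∀ {x z} (ys : List A) (p : x ∈ ys) → z ∈ ys → z ≢ x → z ∈ remove ys p
    ∈-remove (y ∷ ys) (here refl) (here refl) z≢x = ⊥-elim (z≢x refl)
    ∈-remove (y ∷ ys) (here refl) (there q)   _   = q
    ∈-remove (y ∷ ys) (there p)   (here refl) _   = here refl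
    ∈-remove (y ∷ ys) (there p)   (there q)   z≢x = there (∈-remove ys p q z≢x)

  Unique-⊆⇒length≤ : ∀ {xs ys : List A} → Unique xs → xs ⊆ ys → length xs ℕ.≤ length ys
  Unique-⊆⇒length≤ {[]}     _          _    = z≤n
  Unique-⊆⇒length≤ {x ∷ xs} {ys} (x∉xs ∷ xs!) x∷xs⊆ys =
    subst (suc (length xs) ℕ.≤_) (length-remove ys x∈ys)
      (s≤s (Unique-⊆⇒length≤ xs! λ z∈xs →
        ∈-remove ys x∈ys (x∷xs⊆ys (there z∈xs)) (λ z≡x → All.lookup x∉xs z∈xs (sym z≡x))))
    where x∈ys = x∷xs⊆ys (here refl)

  Unique-∷ : ∀ {x : A} {xs} → x ∉ xs → Unique xs → Unique (x ∷ xs)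
  Unique-∷ x∉xs xs! = All.tabulate (λ y∈xs x≡y → x∉xs (subst (_∈ _) (sym x≡y) y∈xs)) ∷ xs!

  AllPairs-from-∈ : ∀ {Q : A → A → Set} {xs : List A} → Unique xs →
    (∀ {x y} → x ∈ xs → y ∈ xs → x ≢ y → Q x y) → AllPairs Q xs
  AllPairs-from-∈ {xs = []}     _            _ = []
  AllPairs-from-∈ {xs = x ∷ xs} (x∉xs ∷ xs!) q =
    All.tabulate (λ y∈xs → q (here refl) (there y∈xs) (All.lookup x∉xs y∈xs))
      ∷ AllPairs-from-∈ xs! (λ p p′ → q (there p) (there p′))

  module _ {B C : Set} (g : A → B → C) where

    Unique-cartesianProductWith : ∀ {xs ys} → Unique xs → Unique ys →
      (∀ {x x′ y y′} → x ∈ xs → x′ ∈ xs → y ∈ ys → y′ ∈ ys → g x y ≡ g x′ y′ → x ≡ x′ × y ≡ y′) →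
      Unique (cartesianProductWith g xs ys)
    Unique-cartesianProductWith {[]}     _            _   _   = []
    Unique-cartesianProductWith {x ∷ xs} {ys} (x∉xs ∷ xs!) ys! inj =
      Unique.++⁺ (Unique-map ys ys! (λ p p′ eq → proj₂ (inj (here refl) (here refl) p p′ eq)))
                 (Unique-cartesianProductWith xs! ys! (λ p p′ → inj (there p) (there p′)))
                 disjoint
      where
      Unique-map : ∀ zs → Unique zs → (∀ {y y′} → y ∈ zs → y′ ∈ zs → g x y ≡ g x y′ → y ≡ y′) →
                   Unique (map (g x) zs)
      Unique-map []       _            _   = []
      Unique-map (z ∷ zs) (z∉zs ∷ zs!) inj′ =
        All.tabulate (λ w∈ gxz≡w → let (y , y∈zs , w≡gxy) = ∈-map⁻ (g x) w∈ in
          All.lookup z∉zs y∈zs (inj′ (here refl) (there y∈zs) (trans gxz≡w w≡gxy)))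
        ∷ Unique-map zs zs! (λ p p′ → inj′ (there p) (there p′))
      disjoint : ∀ {v} → ¬ (v ∈ map (g x) ys × v ∈ cartesianProductWith g xs ys)
      disjoint (v∈map , v∈prod) with ∈-map⁻ (g x) v∈map | ∈-cartesianProductWith⁻ g xs ys v∈prod
      ... | y , y∈ys , refl | x′ , y′ , x′∈xs , y′∈ys , eq =
        All.lookup x∉xs x′∈xs (proj₁ (inj (here refl) (there x′∈xs) y∈ys y′∈ys eq))

    length-cartesianProductWith : ∀ xs ys → length (cartesianProductWith g xs ys) ≡ length xs ℕ.* length ys
    length-cartesianProductWith []       ys = refl
    length-cartesianProductWith (x ∷ xs) ys =
      trans (length-++ (map (g x) ys)) (cong₂ ℕ._+_ (length-map (g x) ys) (length-cartesianProductWith xs ys))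

  module _ {R : A → A → Set} where

    Linked-∷ʳ⁻ : ∀ xs {b c} → Linked R ((xs ++ [ b ]) ++ [ c ]) → R b c
    Linked-∷ʳ⁻ []           (r ∷ [-])    = r
    Linked-∷ʳ⁻ (x ∷ [])     (_ ∷ r ∷ [-]) = r
    Linked-∷ʳ⁻ (x ∷ y ∷ xs) (_ ∷ l)      = Linked-∷ʳ⁻ (y ∷ xs) l

    Linked-++⁻ : ∀ xs {a ys} → Linked R (xs ++ a ∷ ys) → Linked R (xs ++ [ a ]) × Linked R (a ∷ ys)
    Linked-++⁻ []           l       = [-] , l
    Linked-++⁻ (x ∷ [])     (r ∷ l) = r ∷ [-] , l
    Linked-++⁻ (x ∷ y ∷ xs) (r ∷ l) = let (l₁ , l₂) = Linked-++⁻ (y ∷ xs) l in r ∷ l₁ , l₂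

    Linked-++⁺ : ∀ xs {a ys} → Linked R (xs ++ [ a ]) → Linked R (a ∷ ys) → Linked R (xs ++ a ∷ ys)
    Linked-++⁺ []           _        l₂ = l₂
    Linked-++⁺ (x ∷ [])     (r ∷ _)  l₂ = r ∷ l₂
    Linked-++⁺ (x ∷ y ∷ xs) (r ∷ l₁) l₂ = r ∷ Linked-++⁺ (y ∷ xs) l₁ l₂

    Linked-rotate : ∀ {a b} xs ys → Linked R ((a ∷ xs ++ b ∷ ys) ++ [ a ]) → Linked R ((b ∷ ys ++ a ∷ xs) ++ [ b ])
    Linked-rotate {a} {b} xs ys walk =
      subst (Linked R) (cong (b ∷_) (sym (++-assoc ys (a ∷ xs) [ b ])))
        (Linked-++⁺ (b ∷ ys) to-a from-a)
      where
      split = Linked-++⁻ (a ∷ xs) (subst (Linked R) (cong (a ∷_) (++-assoc xs (b ∷ ys) [ a ])) walk)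
      from-a = proj₁ split
      to-a   = proj₂ split

  module _ {P Q : Pred A 0ℓ} (P? : Decidable P) (Q? : Decidable Q) {R : A → A → Set}
           (R-step : ∀ {a b} → R a b → P a → Q b) where

    private
      count-step : ∀ {x y xs ys} → R x y → length (filter P? xs) ℕ.≤ length (filter Q? ys) →
                   length (filter P? (x ∷ xs)) ℕ.≤ length (filter Q? (y ∷ ys))
      count-step {x} {y} r le with P? x | Q? y
      ... | yes p | yes _ = s≤s le
      ... | yes p | no ¬q = ⊥-elim (¬q (R-step r p))
      ... | no _  | yes _ = ℕ.m≤n⇒m≤1+n le
      ... | no _  | no _  = le

    count-Linked : ∀ x ys {z} → Linked R (x ∷ ys ++ [ z ]) →
      length (filter P? (x ∷ ys)) ℕ.≤ length (filter Q? (ys ++ [ z ]))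
    count-Linked x []       (r ∷ _) = count-step r z≤n
    count-Linked x (y ∷ ys) (r ∷ l) = count-step r (count-Linked y ys l)

  length≤1⇒∈-≡ : ∀ {xs : List A} {x y} → length xs ℕ.≤ 1 → x ∈ xs → y ∈ xs → x ≡ y
  length≤1⇒∈-≡ {xs = _ ∷ []}    _        (here x≡a) (here y≡a) = trans x≡a (sym y≡a)
  length≤1⇒∈-≡ {xs = _ ∷ _ ∷ _} (s≤s ()) _          _

module _ {n : ℕ} {P : Pred (Fin n) 0ℓ} (P? : Decidable P) where

  enumerate : List (Fin n)
  enumerate = filter P? (allFin n)

  enumerate-unique : Unique enumerate
  enumerate-unique = Unique.filter⁺ P? (Unique.allFin⁺ n)

  ∈-enumerate⁺ : ∀ {x} → P x → x ∈ enumerate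
  ∈-enumerate⁺ {x} = ∈-filter⁺ P? (∈-allFin x)

  ∈-enumerate⁻ : ∀ {x} → x ∈ enumerate → P x
  ∈-enumerate⁻ = proj₂ ∘ ∈-filter⁻ P? {xs = allFin n}

HasSize⇒length≡ : ∀ {n} {P : Fin n → Set} {k xs} → HasSize P k → Unique xs → (∀ {u} → u ∈ xs ⇔ P u) → length xs ≡ k
HasSize⇒length≡ (ys , ys! , ys⇔P , refl) xs! xs⇔P = ℕ.≤-antisym
  (Unique-⊆⇒length≤ xs! (λ {u} → from (ys⇔P u) ∘ to xs⇔P))
  (Unique-⊆⇒length≤ ys! (λ {u} → from xs⇔P ∘ to (ys⇔P u)))

-- z₁ (1 + v) < z₁ + (1 + u) and z₂ (1 + u) < z₂ + (1 + v) give z₁ v ≤ u ≤ z₂ u ≤ v.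
product-bounds⇒≡1 : ∀ {z₁ z₂ u₁ u₂} → 2 ℕ.≤ z₁ → 1 ℕ.≤ z₂ → 1 ℕ.≤ u₁ → 1 ℕ.≤ u₂ →
  z₁ ℕ.* u₂ ℕ.< z₁ ℕ.+ u₁ → z₂ ℕ.* u₁ ℕ.< z₂ ℕ.+ u₂ → u₁ ≡ 1 × u₂ ≡ 1
product-bounds⇒≡1 {z₁} {z₂@(suc _)} {suc u} {suc v} 2≤z₁ _ _ _ bound₁ bound₂ = cong suc u≡0 , cong suc v≡0
  where
  open ℕ.≤-Reasoning
  shrink : ∀ z {x y} → z ℕ.* suc x ℕ.< z ℕ.+ suc y → z ℕ.* x ℕ.≤ y
  shrink z {x} {y} bound = ℕ.+-cancelˡ-≤ z _ _ (ℕ.≤-pred (begin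
    suc (z ℕ.+ z ℕ.* x)  ≡⟨ cong suc (sym (ℕ.*-suc z x)) ⟩
    suc (z ℕ.* suc x)    ≤⟨ bound ⟩
    z ℕ.+ suc y          ≡⟨ ℕ.+-suc z y ⟩
    suc (z ℕ.+ y)        ∎))
  u≤v : u ℕ.≤ v
  u≤v = ℕ.≤-trans (ℕ.m≤n*m u z₂) (shrink z₂ bound₂)
  v≡0 : v ≡ 0
  v≡0 = ℕ.n≤0⇒n≡0 (ℕ.+-cancelˡ-≤ v _ _ (begin
    v ℕ.+ v        ≡⟨ cong (v ℕ.+_) (sym (ℕ.+-identityʳ v)) ⟩
    2 ℕ.* v        ≤⟨ ℕ.*-monoˡ-≤ v 2≤z₁ ⟩
    z₁ ℕ.* v       ≤⟨ shrink z₁ bound₁ ⟩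
    u              ≤⟨ u≤v ⟩
    v              ≡⟨ sym (ℕ.+-identityʳ v) ⟩
    v ℕ.+ 0        ∎))
  u≡0 : u ≡ 0
  u≡0 = ℕ.n≤0⇒n≡0 (subst (u ℕ.≤_) v≡0 u≤v)

module _ {n : ℕ} (G : SubGraph n) where

  open import Data.List.Membership.DecPropositional (_≟_ {n}) using (_∈?_)
  import Data.List.Relation.Binary.Permutation.Setoid.Properties (≡.setoid (Fin n)) as Perm

  private
    Linked-Vtx : ∀ {xs} → Linked (Adj G) xs → All (Vtx G) xs → Linked (λ a b → Adj G a b × Vtx G b) xs
    Linked-Vtx []      _              = []
    Linked-Vtx [-]     _              = [-]
    Linked-Vtx (r ∷ l) (_ ∷ vb ∷ vbs) = (r , vb) ∷ Linked-Vtx l (vb ∷ vbs)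

    cycle-Vtx : ∀ {C} → (∀ u → (u ∈ C) ⇔ Vtx G u) → All (Vtx G) C
    cycle-Vtx C⇔V = All.tabulate (λ {u} → to (C⇔V u))

  -- Following the cycle one step forward maps S injectively into L.
  hamiltonian⇒length≤neighbours : IsHamiltonian G → ∀ {S L} → Unique S → (∀ {s} → s ∈ S → Vtx G s) →
    (∀ {s w} → s ∈ S → Vtx G w → Adj G s w → w ∈ L) → length S ℕ.≤ length L
  hamiltonian⇒length≤neighbours (v₀ , rest , v₀∉rest ∷ rest! , C⇔V , _ , cycle) {S} {L} S! S⊆V N[S]⊆L = begin
    length S                             ≤⟨ Unique-⊆⇒length≤ S! (λ s∈S → ∈-filter⁺ (_∈? S) (from (C⇔V _) (S⊆V s∈S)) s∈S) ⟩
    length (filter (_∈? S) (v₀ ∷ rest))  ≤⟨ count-Linked (_∈? S) (_∈? L) (λ (adj , vb) s∈S → N[S]⊆L s∈S vb adj) v₀ rest cycle′ ⟩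
    length (filter (_∈? L) (rest ++ [ v₀ ])) ≤⟨ Unique-⊆⇒length≤ (Unique.filter⁺ (_∈? L) shifted!) (proj₂ ∘ ∈-filter⁻ (_∈? L) {xs = rest ++ [ v₀ ]}) ⟩
    length L                             ∎
    where
    open ℕ.≤-Reasoning
    shifted! : Unique (rest ++ [ v₀ ])
    shifted! = Unique.++⁺ rest! ([] ∷ []) λ { (v∈rest , here refl) → All.lookup v₀∉rest v∈rest refl }
    vertices = cycle-Vtx C⇔V
    cycle′ = Linked-Vtx cycle (All.++⁺ vertices (All.head vertices ∷ []))

  private
    CycleAt : Fin n → Set
    CycleAt v = Σ[ rest ∈ List (Fin n) ]
      (Unique (v ∷ rest) × 3 ℕ.≤ length (v ∷ rest) × All (Vtx G) (v ∷ rest) × Linked (Adj G) ((v ∷ rest) ++ [ v ]))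

    cycle-at : IsHamiltonian G → ∀ {v} → Vtx G v → CycleAt v
    cycle-at (v₀ , rest , C! , C⇔V , 3≤C , cycle) {v} v∈V with ∈-∃++ (from (C⇔V v) v∈V)
    ... | []    , q , refl = rest , C! , 3≤C , cycle-Vtx C⇔V , cycle
    ... | x ∷ p , q , refl =
      q ++ x ∷ p ,
      Perm.Unique-resp-↭ perm C! ,
      subst (3 ℕ.≤_) (Perm.xs↭ys⇒|xs|≡|ys| perm) 3≤C ,
      Perm.All-resp-↭ (λ { refl vx → vx }) perm (cycle-Vtx C⇔V) ,
      Linked-rotate p q cycle
      where perm = Perm.++-comm (x ∷ p) (v ∷ q)

  hamiltonian⇒distinct-neighbours : IsHamiltonian G → ∀ {v} → Vtx G v →
    Σ[ u ∈ Fin n ] Σ[ w ∈ Fin n ] (Vtx G u × Vtx G w × u ≢ w × Adj G u v × Adj G v w)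
  hamiltonian⇒distinct-neighbours ham v∈V with cycle-at ham v∈V
  ... | rest , C! , 3≤C , vs , walk with initLast rest
  ...   | [] with s≤s () ← 3≤C
  ...   | [] ∷ʳ′ _ with s≤s (s≤s ()) ← 3≤C
  ...   | (a ∷ init) ∷ʳ′ b with _ ∷ a∉rest ∷ _ ← C! | _ ∷ a∈V ∷ rest⊆V ← vs | v→a ∷ _ ← walk =
    b , a , All.lookup rest⊆V b∈rest , a∈V , (λ b≡a → All.lookup a∉rest b∈rest (sym b≡a)) ,
    Linked-∷ʳ⁻ (_ ∷ a ∷ init) walk , v→a
    where
    b∈rest : b ∈ init ++ [ b ]
    b∈rest = ∈-++⁺ʳ init (here refl)

  regular⇒¬neighbours-⊂ : ∀ {r v a w} → IsRegular G r → Vtx G v → Vtx G a →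
    (∀ {u} → Nbr G v u → Nbr G a u) → Nbr G a w → ¬ Nbr G v w → ⊥
  regular⇒¬neighbours-⊂ {r} {v} {a} {w} reg v∈V a∈V N[v]⊆N[a] a~w v≁w
    with reg v v∈V | reg a a∈V
  ... | Nv , Nv! , Nv⇔ , refl | Na , Na! , Na⇔ , |Na|≡r =
    ℕ.<-irrefl (sym |Na|≡r) (Unique-⊆⇒length≤ (Unique-∷ w∉Nv Nv!) w∷Nv⊆Na)
    where
    w∉Nv : w ∉ Nv
    w∉Nv w∈Nv = v≁w (to (Nv⇔ w) w∈Nv)
    w∷Nv⊆Na : w ∷ Nv ⊆ Na
    w∷Nv⊆Na (here refl) = from (Na⇔ w) a~w
    w∷Nv⊆Na {u} (there u∈Nv) = from (Na⇔ u) (N[v]⊆N[a] (to (Nv⇔ u) u∈Nv))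

  complete⇒independenceNumber≡1 : Σ[ v ∈ Fin n ] Vtx G v →
    (∀ {x y} → Vtx G x → Vtx G y → x ≢ y → Adj G x y) → IndependenceNumberIs G 1
  complete⇒independenceNumber≡1 (v , v∈V) complete = ([ v ] , ([] ∷ [] , v∈V ∷ [] , [] ∷ []) , refl) , bound
    where
    bound : ∀ xs → IsIndependent G xs → length xs ℕ.≤ 1
    bound []          _ = z≤n
    bound (_ ∷ [])    _ = s≤s z≤n
    bound (x ∷ y ∷ _) ((x≢y ∷ _) ∷ _ , x∈V ∷ y∈V ∷ _ , (¬x~y ∷ _) ∷ _) =
      ⊥-elim (¬x~y (complete x∈V y∈V x≢y))

  module CompleteBipartite {P Q : List (Fin n)} (P! : Unique P) (Q! : Unique Q)
    (P⊆V : ∀ {x} → x ∈ P → Vtx G x) (Q⊆V : ∀ {x} → x ∈ Q → Vtx G x)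
    (V⊆P∪Q : ∀ {x} → Vtx G x → x ∈ P ⊎ x ∈ Q)
    (P-independent : ∀ {x y} → x ∈ P → y ∈ P → ¬ Adj G x y)
    (Q-independent : ∀ {x y} → x ∈ Q → y ∈ Q → ¬ Adj G x y)
    (cross : ∀ {x y} → x ∈ P → y ∈ Q → Adj G x y × Adj G y x) where

    private
      independent-⊆ : ∀ {X Y : List (Fin n)} → (∀ {x y} → x ∈ X → y ∈ Y → Adj G x y) →
        ∀ {x xs} → IsIndependent G (x ∷ xs) → x ∈ X → (∀ {y} → Vtx G y → y ∈ X ⊎ y ∈ Y) → x ∷ xs ⊆ X
      independent-⊆ _   _                            x∈X _     (here refl) = x∈X
      independent-⊆ X~Y (_ , _ ∷ xs⊆V , (¬x~xs ∷ _)) x∈X V⊆X∪Y {y} (there y∈xs) with V⊆X∪Y (All.lookup xs⊆V y∈xs)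
      ... | inj₁ y∈X = y∈X
      ... | inj₂ y∈Y = ⊥-elim (All.lookup ¬x~xs y∈xs (X~Y x∈X y∈Y))

    independenceNumber : length Q ℕ.≤ length P → IndependenceNumberIs G (length P)
    independenceNumber |Q|≤|P| =
      (P , (P! , All.tabulate P⊆V , AllPairs-from-∈ P! (λ x∈P y∈P _ → P-independent x∈P y∈P)) , refl) , α≤|P|
      where
      α≤|P| : ∀ xs → IsIndependent G xs → length xs ℕ.≤ length P
      α≤|P| []       _ = z≤n
      α≤|P| (x ∷ xs) ind@(xs! , x∈V ∷ _ , _) with V⊆P∪Q x∈V
      ... | inj₁ x∈P = Unique-⊆⇒length≤ xs! (independent-⊆ (λ p q → proj₁ (cross p q)) ind x∈P V⊆P∪Q)
      ... | inj₂ x∈Q = ℕ.≤-trans (Unique-⊆⇒length≤ xs! (independent-⊆ (λ q p → proj₂ (cross p q)) ind x∈Q (Sum.swap ∘ V⊆P∪Q))) |Q|≤|P|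

    vertex-count : HasSize (Vtx G) (length P ℕ.+ length Q)
    vertex-count = P ++ Q , Unique.++⁺ P! Q! disjoint , (λ u → mk⇔ (Sum.[ P⊆V , Q⊆V ] ∘ ∈-++⁻ P) (Sum.[ ∈-++⁺ˡ , ∈-++⁺ʳ P ] ∘ V⊆P∪Q)) , length-++ P
      where
      disjoint : ∀ {x} → ¬ (x ∈ P × x ∈ Q)
      disjoint (x∈P , x∈Q) = P-independent x∈P x∈P (proj₁ (cross x∈P x∈Q))

    hamiltonian⇒length≤ : IsHamiltonian G → length P ℕ.≤ length Q
    hamiltonian⇒length≤ ham = hamiltonian⇒length≤neighbours ham P! P⊆V N[P]⊆Q
      where
      N[P]⊆Q : ∀ {x w} → x ∈ P → Vtx G w → Adj G x w → w ∈ Q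
      N[P]⊆Q x∈P w∈V x~w with V⊆P∪Q w∈V
      ... | inj₁ w∈P = ⊥-elim (P-independent x∈P w∈P x~w)
      ... | inj₂ w∈Q = w∈Q

  -- t ∷ N(t) contains every vertex, while x ∷ y ∷ N(x) would be one longer.
  regular∧dominating⇒complete : ∀ {r t} → IsRegular G r → Vtx G t → (∀ {w} → Vtx G w → w ≢ t → Adj G t w) →
    ∀ {x y} → Vtx G x → Vtx G y → x ≢ y → ¬ Adj G x y → ⊥
  regular∧dominating⇒complete {t = t} reg t∈V t~all {x} {y} x∈V y∈V x≢y x≁y
    with reg t t∈V | reg x x∈V
  ... | Nt , Nt! , Nt⇔ , refl | Nx , Nx! , Nx⇔ , |Nx|≡r =
    ℕ.<-irrefl |Nx|≡r (ℕ.≤-pred (Unique-⊆⇒length≤ x∷y∷Nx! x∷y∷Nx⊆t∷Nt))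
    where
    x∷y∷Nx! : Unique (x ∷ y ∷ Nx)
    x∷y∷Nx! = Unique-∷ (λ { (here x≡y) → x≢y x≡y ; (there x∈Nx) → proj₁ (proj₂ (to (Nx⇔ x) x∈Nx)) refl })
                (Unique-∷ (λ y∈Nx → x≁y (proj₂ (proj₂ (to (Nx⇔ y) y∈Nx)))) Nx!)
    t∷Nt-covers : ∀ {w} → Vtx G w → w ∈ t ∷ Nt
    t∷Nt-covers {w} w∈V with w ≟ t
    ... | yes refl = here refl
    ... | no w≢t   = there (from (Nt⇔ w) (w∈V , w≢t , t~all w∈V w≢t))
    x∷y∷Nx⊆t∷Nt : x ∷ y ∷ Nx ⊆ t ∷ Nt
    x∷y∷Nx⊆t∷Nt (here refl)           = t∷Nt-covers x∈V
    x∷y∷Nx⊆t∷Nt (there (here refl))   = t∷Nt-covers y∈V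
    x∷y∷Nx⊆t∷Nt {w} (there (there w∈Nx)) = t∷Nt-covers (proj₁ (to (Nx⇔ w) w∈Nx))

module CommutativeRingProperties {A : Set} {plus times : A → A → A} {minus : A → A} {zer one : A}
  (isCommutativeRing : IsCommutativeRing _≡_ plus times minus zer one) where

  private
    ring : CommutativeRing 0ℓ 0ℓ
    ring = record { isCommutativeRing = isCommutativeRing }

  open CommutativeRing ring using (_+_; _*_; -_; 0#; 1#)
  open CommutativeRing ring public
    using (+-assoc; +-comm; +-identityˡ; +-identityʳ; -‿inverseˡ; -‿inverseʳ;
           *-assoc; *-comm; *-identityˡ; *-identityʳ; distribˡ; distribʳ; zeroˡ; zeroʳ)
  open CommutativeRing ring using (+-group; commutativeSemiring; semiring)
  open Semiring semiring using (rawSemiring)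
  open import Algebra.Properties.Group +-group public
    using () renaming (∙-cancelˡ to +-cancelˡ; ∙-cancelʳ to +-cancelʳ; identityʳ-unique to +-identityʳ-unique)
  open import Algebra.Properties.Ring (CommutativeRing.ring ring) public
    using (-‿distribʳ-*; -1*x≈-x)
  open import Algebra.Definitions.RawSemiring rawSemiring public using (_^_)
  open import Algebra.Properties.Semiring.Exp semiring public using (^-homo-*)
  open import Algebra.Properties.CommutativeSemiring.Exp commutativeSemiring public using (^-distrib-*)
  open import Algebra.Solver.Ring.NaturalCoefficients.Default commutativeSemiring public
  open ≡-Reasoning

  infixl 6 _-_
  _-_ : A → A → A
  x - y = x + - y

  Unit : A → Set
  Unit x = Σ[ y ∈ A ] x * y ≡ 1#

  IsNilpotent : A → Set
  IsNilpotent x = Σ[ k ∈ ℕ ] x ^ k ≡ 0#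

  unit⇒x*y≡0⇒y≡0 : ∀ {x y} → Unit x → x * y ≡ 0# → y ≡ 0#
  unit⇒x*y≡0⇒y≡0 {x} {y} (x⁻¹ , x*x⁻¹≡1) xy≡0 = begin
    y               ≡⟨ sym (*-identityˡ y) ⟩
    1# * y          ≡⟨ cong (_* y) (sym x*x⁻¹≡1) ⟩
    (x * x⁻¹) * y   ≡⟨ solve 3 (λ x x⁻¹ y → (x :* x⁻¹) :* y := x⁻¹ :* (x :* y)) refl x x⁻¹ y ⟩
    x⁻¹ * (x * y)   ≡⟨ cong (x⁻¹ *_) xy≡0 ⟩
    x⁻¹ * 0#        ≡⟨ zeroʳ x⁻¹ ⟩
    0#              ∎

  1^k≡1 : ∀ k → 1# ^ k ≡ 1#
  1^k≡1 zero    = refl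
  1^k≡1 (suc k) = trans (*-identityˡ _) (1^k≡1 k)

  unit∧nilpotent⇒1≡0 : ∀ {x} → Unit x → IsNilpotent x → 1# ≡ 0#
  unit∧nilpotent⇒1≡0 {x} (y , xy≡1) (k , xᵏ≡0) = begin
    1#              ≡⟨ sym (1^k≡1 k) ⟩
    1# ^ k          ≡⟨ cong (_^ k) (sym xy≡1) ⟩
    (x * y) ^ k     ≡⟨ ^-distrib-* x y k ⟩
    x ^ k * y ^ k   ≡⟨ cong (_* y ^ k) xᵏ≡0 ⟩
    0# * y ^ k      ≡⟨ zeroˡ _ ⟩
    0#              ∎

  nilpotent-*ˡ : ∀ y {x} → IsNilpotent x → IsNilpotent (y * x)
  nilpotent-*ˡ y {x} (k , xᵏ≡0) = k , (begin
    (y * x) ^ k     ≡⟨ ^-distrib-* y x k ⟩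
    y ^ k * x ^ k   ≡⟨ cong (y ^ k *_) xᵏ≡0 ⟩
    y ^ k * 0#      ≡⟨ zeroʳ _ ⟩
    0#              ∎)

  nilpotent-neg : ∀ {x} → IsNilpotent x → IsNilpotent (- x)
  nilpotent-neg {x} nil = subst IsNilpotent (-1*x≈-x x) (nilpotent-*ˡ (- 1#) nil)

  -- The inverse of 1 + x is the truncated geometric series Σ_{i<k} (-x)^i.
  1+nilpotent⇒unit : ∀ {x} → IsNilpotent x → Unit (1# + x)
  1+nilpotent⇒unit {x} nil with k , [-x]ᵏ≡0 ← nilpotent-neg nil =
    geometric k , trans (sym (+-identityʳ _)) (trans (cong ((1# + x) * geometric k +_) (sym [-x]ᵏ≡0)) (telescope k))
    where
    geometric : ℕ → A
    geometric zero    = 0#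
    geometric (suc k) = 1# + - x * geometric k

    telescope : ∀ k → (1# + x) * geometric k + (- x) ^ k ≡ 1#
    telescope zero    = trans (cong (_+ 1#) (zeroʳ _)) (+-identityˡ 1#)
    telescope (suc k) = begin
      u * (1# + t * g) + t * t ^ k ≡⟨ solve 4 (λ u t g p → u :* (con 1 :+ t :* g) :+ t :* p := u :+ t :* (u :* g :+ p)) refl u t g (t ^ k) ⟩
      u + t * (u * g + t ^ k)      ≡⟨ cong (λ z → u + t * z) (telescope k) ⟩
      u + t * 1#                   ≡⟨ solve 2 (λ x t → (con 1 :+ x) :+ t :* con 1 := con 1 :+ (x :+ t)) refl x t ⟩
      1# + (x + - x)               ≡⟨ cong (1# +_) (-‿inverseʳ x) ⟩
      1# + 0#                      ≡⟨ +-identityʳ 1# ⟩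
      1#                           ∎
      where u = 1# + x
            t = - x
            g = geometric k

  x*y≡0⇒[g*x]*[g*y]≡0 : ∀ g {x y} → x * y ≡ 0# → (g * x) * (g * y) ≡ 0#
  x*y≡0⇒[g*x]*[g*y]≡0 g {x} {y} xy≡0 = begin
    (g * x) * (g * y)  ≡⟨ solve 3 (λ g x y → (g :* x) :* (g :* y) := (g :* g) :* (x :* y)) refl g x y ⟩
    (g * g) * (x * y)  ≡⟨ cong ((g * g) *_) xy≡0 ⟩
    (g * g) * 0#       ≡⟨ zeroʳ _ ⟩
    0#                 ∎

  record Splitting : Set where
    field
      e f       : A
      e*e≡e     : e * e ≡ e
      f*f≡f     : f * f ≡ f
      e*f≡0     : e * f ≡ 0#
      e+f≡1     : e + f ≡ 1#
      e≢0       : e ≢ 0#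
      f≢0       : f ≢ 0#

    e*x+f*x≡x : ∀ x → e * x + f * x ≡ x
    e*x+f*x≡x x = trans (sym (distribʳ x e f)) (trans (cong (_* x) e+f≡1) (*-identityˡ x))

    f*x≡0⇒e*x≡x : ∀ {x} → f * x ≡ 0# → e * x ≡ x
    f*x≡0⇒e*x≡x {x} fx≡0 = trans (sym (+-identityʳ (e * x))) (trans (cong (e * x +_) (sym fx≡0)) (e*x+f*x≡x x))

    e*x≡0⇒f*x≡x : ∀ {x} → e * x ≡ 0# → f * x ≡ x
    e*x≡0⇒f*x≡x {x} ex≡0 = trans (sym (+-identityˡ (f * x))) (trans (cong (_+ f * x) (sym ex≡0)) (e*x+f*x≡x x))

    e*[f*x]≡0 : ∀ x → e * (f * x) ≡ 0#
    e*[f*x]≡0 x = trans (sym (*-assoc e f x)) (trans (cong (_* x) e*f≡0) (zeroˡ x))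

    f*[e*x]≡0 : ∀ x → f * (e * x) ≡ 0#
    f*[e*x]≡0 x = trans (sym (*-assoc f e x)) (trans (cong (_* x) (trans (*-comm f e) e*f≡0)) (zeroˡ x))

    e*x≡x⇒f*x≡0 : ∀ {x} → e * x ≡ x → f * x ≡ 0#
    e*x≡x⇒f*x≡0 {x} ex≡x = trans (cong (f *_) (sym ex≡x)) (f*[e*x]≡0 x)

    e*[e*x]≡e*x : ∀ x → e * (e * x) ≡ e * x
    e*[e*x]≡e*x x = trans (sym (*-assoc e e x)) (cong (_* x) e*e≡e)

    f*[f*x]≡f*x : ∀ x → f * (f * x) ≡ f * x
    f*[f*x]≡f*x x = trans (sym (*-assoc f f x)) (cong (_* x) f*f≡f)

    e*x≡x∧f*y≡y⇒x*y≡0 : ∀ {x y} → e * x ≡ x → f * y ≡ y → x * y ≡ 0#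
    e*x≡x∧f*y≡y⇒x*y≡0 {x} {y} ex≡x fy≡y = begin
      x * y              ≡⟨ cong₂ _*_ (sym ex≡x) (sym fy≡y) ⟩
      (e * x) * (f * y)  ≡⟨ solve 4 (λ e f x y → (e :* x) :* (f :* y) := (e :* f) :* (x :* y)) refl e f x y ⟩
      (e * f) * (x * y)  ≡⟨ cong (_* (x * y)) e*f≡0 ⟩
      0# * (x * y)       ≡⟨ zeroˡ _ ⟩
      0#                 ∎

  swap : Splitting → Splitting
  swap s = record
    { e = f ; f = e ; e*e≡e = f*f≡f ; f*f≡f = e*e≡e ; e*f≡0 = trans (*-comm f e) e*f≡0
    ; e+f≡1 = trans (+-comm f e) e+f≡1 ; e≢0 = f≢0 ; f≢0 = e≢0 }
    where open Splitting s

  idempotent⇒complement : ∀ {e} → e * e ≡ e → Σ[ f ∈ A ] (e + f ≡ 1# × e * f ≡ 0# × f * f ≡ f)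
  idempotent⇒complement {e} e*e≡e = f , e+f≡1 , e*f≡0 , f*f≡f
    where
    f = - e + 1#
    e+f≡1 : e + f ≡ 1#
    e+f≡1 = trans (sym (+-assoc e (- e) 1#)) (trans (cong (_+ 1#) (-‿inverseʳ e)) (+-identityˡ 1#))
    e*f≡0 : e * f ≡ 0#
    e*f≡0 = +-identityʳ-unique e (e * f) (begin
      e + e * f       ≡⟨ cong (_+ e * f) (sym e*e≡e) ⟩
      e * e + e * f   ≡⟨ sym (distribˡ e e f) ⟩
      e * (e + f)     ≡⟨ cong (e *_) e+f≡1 ⟩
      e * 1#          ≡⟨ *-identityʳ e ⟩
      e               ∎)
    f*f≡f : f * f ≡ f
    f*f≡f = begin
      f * f           ≡⟨ sym (+-identityˡ (f * f)) ⟩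
      0# + f * f      ≡⟨ cong (_+ f * f) (sym (trans (*-comm f e) e*f≡0)) ⟩
      f * e + f * f   ≡⟨ sym (distribˡ f e f) ⟩
      f * (e + f)     ≡⟨ cong (f *_) e+f≡1 ⟩
      f * 1#          ≡⟨ *-identityʳ f ⟩
      f               ∎

  idempotent⇒splitting : ∀ {e} → e * e ≡ e → e ≢ 0# → e ≢ 1# → Splitting
  idempotent⇒splitting {e} e*e≡e e≢0 e≢1 with f , e+f≡1 , e*f≡0 , f*f≡f ← idempotent⇒complement e*e≡e = record
    { e = e ; f = f ; e*e≡e = e*e≡e ; f*f≡f = f*f≡f ; e*f≡0 = e*f≡0 ; e+f≡1 = e+f≡1 ; e≢0 = e≢0
    ; f≢0 = λ f≡0 → e≢1 (trans (sym (+-identityʳ e)) (trans (cong (e +_) (sym f≡0)) e+f≡1)) }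

module FiniteCommutativeRing (R : FinCommRing) where

  open FinCommRing R using (size; Carrier; _+_; _*_; -_; 0#; 1#; isCommutativeRing; rawRing)
  open CommutativeRingProperties isCommutativeRing public
  open ≡-Reasoning

  private
    periodic : ∀ x {i p} → x ^ (i ℕ.+ p) ≡ x ^ i → ∀ s c → x ^ (s ℕ.+ i ℕ.+ c ℕ.* p) ≡ x ^ (s ℕ.+ i)
    periodic x {i} {p} period s zero = cong (x ^_) (ℕ.+-identityʳ (s ℕ.+ i))
    periodic x {i} {p} period s (suc c) = begin
      x ^ (s ℕ.+ i ℕ.+ (p ℕ.+ c ℕ.* p))  ≡⟨ cong (x ^_) (rearrange₁ s i p c) ⟩
      x ^ (s ℕ.+ c ℕ.* p ℕ.+ (i ℕ.+ p))  ≡⟨ ^-homo-* x (s ℕ.+ c ℕ.* p) (i ℕ.+ p) ⟩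
      x ^ (s ℕ.+ c ℕ.* p) * x ^ (i ℕ.+ p) ≡⟨ cong (x ^ (s ℕ.+ c ℕ.* p) *_) period ⟩
      x ^ (s ℕ.+ c ℕ.* p) * x ^ i         ≡⟨ sym (^-homo-* x (s ℕ.+ c ℕ.* p) i) ⟩
      x ^ (s ℕ.+ c ℕ.* p ℕ.+ i)           ≡⟨ cong (x ^_) (rearrange₂ s c p i) ⟩
      x ^ (s ℕ.+ i ℕ.+ c ℕ.* p)           ≡⟨ periodic x period s c ⟩
      x ^ (s ℕ.+ i)                       ∎
      where
      rearrange₁ : ∀ s i p c → s ℕ.+ i ℕ.+ (p ℕ.+ c ℕ.* p) ≡ s ℕ.+ c ℕ.* p ℕ.+ (i ℕ.+ p)
      rearrange₁ = solve-∀
      rearrange₂ : ∀ s c p i → s ℕ.+ c ℕ.* p ℕ.+ i ≡ s ℕ.+ i ℕ.+ c ℕ.* p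
      rearrange₂ = solve-∀

  -- Fitting: the powers of x are eventually periodic, so some power is idempotent.
  idempotent-power : ∀ x → Σ[ m ∈ ℕ ] x ^ suc m * x ^ suc m ≡ x ^ suc m
  idempotent-power x with i , j , i<j , xⁱ≡xʲ ← pigeonhole (ℕ.n<1+n size) (λ k → x ^ toℕ k) =
    m , trans (sym (^-homo-* x (suc m) (suc m))) (begin
      x ^ (suc m ℕ.+ suc m)                ≡⟨ cong (λ k → x ^ (k ℕ.+ suc m)) (sym t+i≡m+1) ⟩
      x ^ (t ℕ.+ toℕ i ℕ.+ suc m)          ≡⟨ periodic x period t (suc (toℕ i)) ⟩
      x ^ (t ℕ.+ toℕ i)                    ≡⟨ cong (x ^_) t+i≡m+1 ⟩
      x ^ suc m                            ∎)
    where
    k = toℕ j ℕ.∸ suc (toℕ i)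
    period : x ^ (toℕ i ℕ.+ suc k) ≡ x ^ toℕ i
    period = trans (cong (x ^_) (trans (ℕ.+-suc (toℕ i) k) (ℕ.m+[n∸m]≡n i<j))) (sym xⁱ≡xʲ)
    m = k ℕ.+ toℕ i ℕ.* suc k
    t = suc m ℕ.∸ toℕ i
    t+i≡m+1 : t ℕ.+ toℕ i ≡ suc m
    t+i≡m+1 = ℕ.m∸n+n≡m (ℕ.≤-trans (ℕ.n≤1+n (toℕ i)) (ℕ.m≤m*n (suc (toℕ i)) (suc k)))

  -- If x is not a zero-divisor, the idempotent g = x^(m+1) satisfies g (g - 1) = 0, so g = 1.
  non-zero-divisor⇒unit : ∀ {x} → (∀ y → x * y ≡ 0# → y ≡ 0#) → Unit x
  non-zero-divisor⇒unit {x} x-cancel with m , g*g≡g ← idempotent-power x = x ^ m , g≡1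
    where
    g = x ^ suc m
    xᵏ-cancel : ∀ k y → x ^ k * y ≡ 0# → y ≡ 0#
    xᵏ-cancel zero    y y≡0 = trans (sym (*-identityˡ y)) y≡0
    xᵏ-cancel (suc k) y xᵏ⁺¹y≡0 = xᵏ-cancel k y (x-cancel _ (trans (sym (*-assoc x _ y)) xᵏ⁺¹y≡0))
    g*[g-1]≡0 : g * (g - 1#) ≡ 0#
    g*[g-1]≡0 = begin
      g * (g - 1#)       ≡⟨ distribˡ g g (- 1#) ⟩
      g * g + g * - 1#   ≡⟨ cong₂ _+_ g*g≡g (sym (-‿distribʳ-* g 1#)) ⟩
      g - g * 1#         ≡⟨ cong (λ z → g - z) (*-identityʳ g) ⟩
      g - g              ≡⟨ -‿inverseʳ g ⟩
      0#                 ∎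
    g≡1 : g ≡ 1#
    g≡1 = +-cancelʳ (- 1#) g 1# (trans (xᵏ-cancel (suc m) _ g*[g-1]≡0) (sym (-‿inverseʳ 1#)))

  -- For a finite commutative ring, having no idempotents but 0 and 1 is equivalent to being local.
  IsLocal : Set
  IsLocal = ∀ e → e * e ≡ e → e ≡ 0# ⊎ e ≡ 1#

  splitting⊎local : Splitting ⊎ IsLocal
  splitting⊎local with any? (λ e → (e * e ≟ e) ×-dec ¬? (e ≟ 0#) ×-dec ¬? (e ≟ 1#))
  ... | yes (e , e*e≡e , e≢0 , e≢1) = inj₁ (idempotent⇒splitting e*e≡e e≢0 e≢1)
  ... | no ¬nontrivial = inj₂ trivial
    where
    trivial : IsLocal
    trivial e e*e≡e with e ≟ 0# | e ≟ 1#
    ... | yes e≡0 | _       = inj₁ e≡0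
    ... | no _    | yes e≡1 = inj₂ e≡1
    ... | no e≢0  | no e≢1  = ⊥-elim (¬nontrivial (e , e*e≡e , e≢0 , e≢1))

  local⇒unit⊎nilpotent : IsLocal → ∀ x → Unit x ⊎ IsNilpotent x
  local⇒unit⊎nilpotent local x with m , g*g≡g ← idempotent-power x with local _ g*g≡g
  ... | inj₁ g≡0 = inj₂ (suc m , g≡0)
  ... | inj₂ g≡1 = inj₁ (x ^ m , g≡1)

  local⇒zero-divisor⇒nilpotent : IsLocal → ∀ {x} → IsZeroDivisor R x → IsNilpotent x
  local⇒zero-divisor⇒nilpotent local {x} (y , y≢0 , xy≡0) with local⇒unit⊎nilpotent local x
  ... | inj₁ unit = ⊥-elim (y≢0 (unit⇒x*y≡0⇒y≡0 unit xy≡0))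
  ... | inj₂ nil  = nil

  annihilator-descent : ∀ {z} y → y ≢ 0# → ∀ k → y * z ^ k ≡ 0# →
    Σ[ s ∈ Carrier ] (y * s ≢ 0# × (y * s) * z ≡ 0#)
  annihilator-descent y y≢0 zero y≡0 = ⊥-elim (y≢0 (trans (sym (*-identityʳ y)) y≡0))
  annihilator-descent {z} y y≢0 (suc k) yzᵏ⁺¹≡0 with y * z ≟ 0#
  ... | yes yz≡0 = 1# , y≢0 ∘ trans (sym (*-identityʳ y)) , trans (cong (_* z) (*-identityʳ y)) yz≡0
  ... | no yz≢0 with s , yzs≢0 , yzs*z≡0 ← annihilator-descent (y * z) yz≢0 k (trans (*-assoc y z _) yzᵏ⁺¹≡0) =
    z * s , yzs≢0 ∘ trans (*-assoc y z s) , trans (cong (_* z) (sym (*-assoc y z s))) yzs*z≡0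

  common-annihilator : ∀ zs → All IsNilpotent zs → ∀ y → y ≢ 0# →
    Σ[ t ∈ Carrier ] (y * t ≢ 0# × All (λ z → (y * t) * z ≡ 0#) zs)
  common-annihilator []       _                  y y≢0 = 1# , y≢0 ∘ trans (sym (*-identityʳ y)) , []
  common-annihilator (z ∷ zs) ((k , zᵏ≡0) ∷ nil) y y≢0
    with s , ys≢0 , ys*z≡0 ← annihilator-descent y y≢0 k (trans (cong (y *_) zᵏ≡0) (zeroʳ y))
    with t , yst≢0 , yst-kills ← common-annihilator zs nil (y * s) ys≢0 =
    s * t , yst≢0 ∘ trans (*-assoc y s t) , kills-z ∷ All.map (trans (cong (_* _) (sym (*-assoc y s t)))) yst-kills
    where
    kills-z : (y * (s * t)) * z ≡ 0#
    kills-z = begin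
      (y * (s * t)) * z  ≡⟨ solve 4 (λ y s t z → (y :* (s :* t)) :* z := ((y :* s) :* z) :* t) refl y s t z ⟩
      ((y * s) * z) * t  ≡⟨ cong (_* t) ys*z≡0 ⟩
      0# * t             ≡⟨ zeroˡ t ⟩
      0#                 ∎

  -- R/(1 - e), presented on the carrier of R with equality x ≈ y := e x ≡ e y.
  module Component (e : Carrier) where

    infix 4 _≈_
    _≈_ : Carrier → Carrier → Set
    x ≈ y = e * x ≡ e * y

    private
      lift : ∀ {x y} → x ≡ y → x ≈ y
      lift = cong (e *_)

      +-cong : ∀ {x y u v} → x ≈ y → u ≈ v → x + u ≈ y + v
      +-cong {x} {y} {u} {v} x≈y u≈v = trans (distribˡ e x u) (trans (cong₂ _+_ x≈y u≈v) (sym (distribˡ e y v)))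

      *-cong : ∀ {x y u v} → x ≈ y → u ≈ v → x * u ≈ y * v
      *-cong {x} {y} {u} {v} x≈y u≈v = begin
        e * (x * u)  ≡⟨ sym (*-assoc e x u) ⟩
        (e * x) * u  ≡⟨ cong (_* u) x≈y ⟩
        (e * y) * u  ≡⟨ solve 3 (λ e y u → (e :* y) :* u := (e :* u) :* y) refl e y u ⟩
        (e * u) * y  ≡⟨ cong (_* y) u≈v ⟩
        (e * v) * y  ≡⟨ solve 3 (λ e v y → (e :* v) :* y := e :* (y :* v)) refl e v y ⟩
        e * (y * v)  ∎

      -‿cong : ∀ {x y} → x ≈ y → - x ≈ - y
      -‿cong {x} {y} x≈y = trans (sym (-‿distribʳ-* e x)) (trans (cong -_ x≈y) (-‿distribʳ-* e y))

    commutativeRing : CommutativeRing 0ℓ 0ℓ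
    commutativeRing = record
      { _≈_ = _≈_
      ; isCommutativeRing = record
        { isRing = record
          { +-isAbelianGroup = record
            { isGroup = record
              { isMonoid = record
                { isSemigroup = record
                  { isMagma = record { isEquivalence = record { refl = refl ; sym = sym ; trans = trans } ; ∙-cong = +-cong }
                  ; assoc = λ x y z → lift (+-assoc x y z) }
                ; identity = (λ x → lift (+-identityˡ x)) , (λ x → lift (+-identityʳ x)) }
              ; inverse = (λ x → lift (-‿inverseˡ x)) , (λ x → lift (-‿inverseʳ x))
              ; ⁻¹-cong = -‿cong }
            ; comm = λ x y → lift (+-comm x y) }
          ; *-cong = *-cong
          ; *-assoc = λ x y z → lift (*-assoc x y z)
          ; *-identity = (λ x → lift (*-identityˡ x)) , (λ x → lift (*-identityʳ x))
          ; distrib = (λ x y z → lift (distribˡ x y z)) , (λ x y z → lift (distribʳ x y z)) }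
        ; *-comm = λ x y → lift (*-comm x y) } }

    nontrivial : e ≢ 0# → ¬ (1# ≈ 0#)
    nontrivial e≢0 e≡0 = e≢0 (trans (sym (*-identityʳ e)) (trans e≡0 (zeroʳ e)))

  splitting⇒decomposable : Splitting → IsDecomposable R
  splitting⇒decomposable s =
    E.commutativeRing , F.commutativeRing , E.nontrivial e≢0 , F.nontrivial f≢0 , (λ x → x , x) , isomorphism
    where
    open Splitting s
    module E = Component e
    module F = Component f
    injective : ∀ {x y} → e * x ≡ e * y × f * x ≡ f * y → x ≡ y
    injective {x} {y} (ex≡ey , fx≡fy) = trans (sym (e*x+f*x≡x x)) (trans (cong₂ _+_ ex≡ey fx≡fy) (e*x+f*x≡x y))
    preimage : ∀ a b → e * (e * a + f * b) ≡ e * a × f * (e * a + f * b) ≡ f * b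
    preimage a b =
      trans (distribˡ e _ _) (trans (cong₂ _+_ (e*[e*x]≡e*x a) (e*[f*x]≡0 b)) (+-identityʳ _)) ,
      trans (distribˡ f _ _) (trans (cong₂ _+_ (f*[e*x]≡0 a) (f*[f*x]≡f*x b)) (+-identityˡ _))
    isomorphism : IsRingIsomorphism rawRing (CommutativeRing.rawRing (DirectProduct.commutativeRing E.commutativeRing F.commutativeRing)) (λ x → x , x)
    isomorphism = record
      { isRingMonomorphism = record
        { isRingHomomorphism = record
          { isSemiringHomomorphism = record
            { isNearSemiringHomomorphism = record
              { +-isMonoidHomomorphism = record
                { isMagmaHomomorphism = record
                  { isRelHomomorphism = record { cong = λ x≡y → cong (e *_) x≡y , cong (f *_) x≡y }
                  ; homo = λ _ _ → refl , refl }
                ; ε-homo = refl , refl }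
              ; *-homo = λ _ _ → refl , refl }
            ; 1#-homo = refl , refl }
          ; -‿homo = λ _ → refl , refl }
        ; injective = injective }
      ; surjective = λ (a , b) → e * a + f * b , λ { refl → preimage a b } }

  -- The preimage of (1, 0) under R ≅ R₁ × R₂ is a nontrivial idempotent.
  decomposable⇒splitting : IsDecomposable R → Splitting
  decomposable⇒splitting (R₁ , R₂ , 1≉0 , 1≉0′ , φ , isomorphism) = idempotent⇒splitting e*e≡e e≢0 e≢1
    where
    module P = CommutativeRing (DirectProduct.commutativeRing R₁ R₂)
    module R₁ = CommutativeRing R₁
    module R₂ = CommutativeRing R₂
    open IsRingIsomorphism isomorphism
    e : Carrier
    e = proj₁ (surjective (R₁.1# , R₂.0#))
    φe≈[1,0] : φ e P.≈ (R₁.1# , R₂.0#)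
    φe≈[1,0] = proj₂ (surjective (R₁.1# , R₂.0#)) refl
    e*e≡e : e * e ≡ e
    e*e≡e = injective (P.trans (*-homo e e) (P.trans (P.*-cong φe≈[1,0] φe≈[1,0])
              (P.trans (R₁.*-identityˡ R₁.1# , R₂.zeroˡ R₂.0#) (P.sym φe≈[1,0]))))
    e≢0 : e ≢ 0#
    e≢0 e≡0 = 1≉0 (R₁.sym (proj₁ (P.trans (P.sym 0#-homo) (subst (λ z → φ z P.≈ _) e≡0 φe≈[1,0]))))
    e≢1 : e ≢ 1#
    e≢1 e≡1 = 1≉0′ (proj₂ (P.trans (P.sym 1#-homo) (subst (λ z → φ z P.≈ _) e≡1 φe≈[1,0])))

  idempotent⇒^suc≡ : ∀ {h} → h * h ≡ h → ∀ k → h ^ suc k ≡ h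
  idempotent⇒^suc≡ {h} h*h≡h zero    = *-identityʳ h
  idempotent⇒^suc≡ {h} h*h≡h (suc k) = trans (cong (h *_) (idempotent⇒^suc≡ h*h≡h k)) h*h≡h

  -- With g = x^(m+1) idempotent and h = 1 - g: x g + h is a unit (inverse x^m g + h), and 1 + x h
  -- is a unit since x h is nilpotent; both being 1 forces x = x g + x h = g.
  trivial-units⇒boolean : (∀ u → Unit u → u ≡ 1#) → ∀ x → x * x ≡ x
  trivial-units⇒boolean units≡1 x
    with m , g*g≡g ← idempotent-power x
    with h , g+h≡1 , g*h≡0 , h*h≡h ← idempotent⇒complement g*g≡g = subst (λ t → t * t ≡ t) (sym x≡g) g*g≡g
    where
    g = x ^ suc m
    xg+h-unit : Unit (x * g + h)
    xg+h-unit = x ^ m * g + h , (begin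
      (x * g + h) * (x ^ m * g + h)               ≡⟨ solve 4 (λ x y g h → (x :* g :+ h) :* (y :* g :+ h) := (x :* y) :* (g :* g) :+ ((g :* h) :* (x :+ y) :+ h :* h)) refl x (x ^ m) g h ⟩
      g * (g * g) + ((g * h) * (x + x ^ m) + h * h) ≡⟨ cong₂ (λ a b → g * a + (b * (x + x ^ m) + h * h)) g*g≡g g*h≡0 ⟩
      g * g + (0# * (x + x ^ m) + h * h)          ≡⟨ cong₂ (λ a b → a + (b + h * h)) g*g≡g (zeroˡ _) ⟩
      g + (0# + h * h)                            ≡⟨ cong (g +_) (trans (+-identityˡ _) h*h≡h) ⟩
      g + h                                       ≡⟨ g+h≡1 ⟩
      1#                                          ∎)
    xg≡g : x * g ≡ g
    xg≡g = +-cancelʳ h (x * g) g (trans (units≡1 _ xg+h-unit) (sym g+h≡1))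
    xh-nilpotent : IsNilpotent (x * h)
    xh-nilpotent = suc m , trans (^-distrib-* x h (suc m)) (trans (cong (g *_) (idempotent⇒^suc≡ h*h≡h m)) g*h≡0)
    xh≡0 : x * h ≡ 0#
    xh≡0 = +-identityʳ-unique 1# (x * h) (units≡1 _ (1+nilpotent⇒unit xh-nilpotent))
    x≡g : x ≡ g
    x≡g = begin
      x              ≡⟨ sym (*-identityʳ x) ⟩
      x * 1#         ≡⟨ cong (x *_) (sym g+h≡1) ⟩
      x * (g + h)    ≡⟨ distribˡ x g h ⟩
      x * g + x * h  ≡⟨ cong₂ _+_ xg≡g xh≡0 ⟩
      g + 0#         ≡⟨ +-identityʳ g ⟩
      g              ∎

  module _ (boolean : ∀ x → x * x ≡ x) where

    private
      refine : ∀ zs {c} → c ≢ 0# →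
        Σ[ a ∈ Carrier ] (a ≢ 0# × a * c ≡ a × All (λ z → z * a ≡ 0# ⊎ z * a ≡ a) zs)
      refine []       {c} c≢0 = c , c≢0 , boolean c , []
      refine (z ∷ zs) {c} c≢0 with a , a≢0 , ac≡a , zs-split ← refine zs c≢0 with z * a ≟ 0# | z * a ≟ a
      ... | yes za≡0 | _       = a , a≢0 , ac≡a , inj₁ za≡0 ∷ zs-split
      ... | no _     | yes za≡a = a , a≢0 , ac≡a , inj₂ za≡a ∷ zs-split
      ... | no za≢0  | no _    =
        z * a , za≢0 , trans (*-assoc z a c) (cong (z *_) ac≡a) ,
        inj₂ (trans (sym (*-assoc z z a)) (cong (_* a) (boolean z))) ∷ All.map refine-split zs-split
        where
        swap-z : ∀ w → w * (z * a) ≡ z * (w * a)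
        swap-z w = solve 3 (λ w z a → w :* (z :* a) := z :* (w :* a)) refl w z a
        refine-split : ∀ {w} → w * a ≡ 0# ⊎ w * a ≡ a → w * (z * a) ≡ 0# ⊎ w * (z * a) ≡ z * a
        refine-split {w} (inj₁ wa≡0) = inj₁ (trans (swap-z w) (trans (cong (z *_) wa≡0) (zeroʳ z)))
        refine-split {w} (inj₂ wa≡a) = inj₂ (trans (swap-z w) (cong (z *_) wa≡a))

    boolean⇒atom-below : ∀ {c} → c ≢ 0# →
      Σ[ a ∈ Carrier ] (a ≢ 0# × a * c ≡ a × ∀ z → z * a ≡ 0# ⊎ z * a ≡ a)
    boolean⇒atom-below c≢0 with a , a≢0 , ac≡a , split ← refine (allFin size) c≢0 =
      a , a≢0 , ac≡a , λ z → All.lookup split (∈-allFin z)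

module ZeroDivisorGraph (R : FinCommRing) where

  open FinCommRing R using (size; Carrier; _+_; _*_; -_; 0#; 1#)
  open FiniteCommutativeRing R
  open ≡-Reasoning

  Vertex : Carrier → Set
  Vertex = IsZeroDivisorStar R

  zero-divisor? : ∀ x → Dec (IsZeroDivisor R x)
  zero-divisor? x = any? (λ y → ¬? (y ≟ 0#) ×-dec (x * y ≟ 0#))

  vertex-exists : 1# ≢ 0# → ¬ IsIntegralDomain R → Σ[ x ∈ Carrier ] Vertex x
  vertex-exists 1≢0 ¬domain with any? (λ x → zero-divisor? x ×-dec ¬? (x ≟ 0#))
  ... | yes vertex   = vertex
  ... | no ¬vertex = ⊥-elim (¬domain (1≢0 , domain))
    where
    domain : ∀ x y → x * y ≡ 0# → x ≡ 0# ⊎ y ≡ 0#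
    domain x y xy≡0 with x ≟ 0# | y ≟ 0#
    ... | yes x≡0 | _       = inj₁ x≡0
    ... | no _    | yes y≡0 = inj₂ y≡0
    ... | no x≢0  | no y≢0  = ⊥-elim (¬vertex (x , (y , y≢0 , xy≡0) , x≢0))

  local⇒annihilator-of-zero-divisors : IsLocal → Σ[ x ∈ Carrier ] Vertex x →
    Σ[ t ∈ Carrier ] (Vertex t × ∀ {z} → IsZeroDivisor R z → t * z ≡ 0#)
  local⇒annihilator-of-zero-divisors local (x , x-zd , x≢0)
    with t , xt≢0 , xt-kills ← common-annihilator (enumerate zero-divisor?)
           (All.tabulate (local⇒zero-divisor⇒nilpotent local ∘ ∈-enumerate⁻ zero-divisor?)) x x≢0 =
    x * t , ((x , x≢0 , kills x-zd) , xt≢0) , kills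
    where
    kills : ∀ {z} → IsZeroDivisor R z → (x * t) * z ≡ 0#
    kills = All.lookup xt-kills ∘ ∈-enumerate⁺ zero-divisor?

  local∧regular⇒complete : IsLocal → ∀ {r} → IsRegular (Γ R) r → Σ[ x ∈ Carrier ] Vertex x →
    ∀ {x y} → Vertex x → Vertex y → x ≢ y → Adj (Γ R) x y
  local∧regular⇒complete local reg vertex {x} {y} x∈V y∈V x≢y =
    x≢y , decidable-stable (x * y ≟ 0#) λ xy≢0 →
      regular∧dominating⇒complete (Γ R) reg t∈V t~all x∈V y∈V x≢y (xy≢0 ∘ proj₂)
    where
    annihilator = local⇒annihilator-of-zero-divisors local vertex
    t = proj₁ annihilator
    t∈V : Vertex t
    t∈V = proj₁ (proj₂ annihilator)
    t~all : ∀ {w} → Vertex w → w ≢ t → Adj (Γ R) t w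
    t~all (w-zd , _) w≢t = w≢t ∘ sym , proj₂ (proj₂ annihilator) w-zd

  NoZeroDivisorsIn : Carrier → Set
  NoZeroDivisorsIn e = ∀ {a b} → e * a ≡ a → e * b ≡ b → a ≢ 0# → b ≢ 0# → a * b ≢ 0#

  -- If a, b ∈ eR are nonzero with ab = 0, then N(e) ⊆ N(a) while b + f ∈ N(a) ∖ N(e).
  regular⇒no-zero-divisors : ∀ {r} → IsRegular (Γ R) r → (s : Splitting) → NoZeroDivisorsIn (Splitting.e s)
  regular⇒no-zero-divisors reg s {a} {b} ea≡a eb≡b a≢0 b≢0 ab≡0 =
    regular⇒¬neighbours-⊂ (Γ R) reg e∈V a∈V N[e]⊆N[a] a~w e≁w
    where
    open Splitting s
    e∈V : Vertex e
    e∈V = (f , f≢0 , e*f≡0) , e≢0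
    a∈V : Vertex a
    a∈V = (b , b≢0 , ab≡0) , a≢0
    N[e]⊆N[a] : ∀ {u} → Nbr (Γ R) e u → Nbr (Γ R) a u
    N[e]⊆N[a] {u} (u∈V , u≢e , _ , eu≡0) = u∈V , u≢a , u≢a ∘ sym , au≡0
      where
      au≡0 : a * u ≡ 0#
      au≡0 = begin
        a * u        ≡⟨ cong (_* u) (sym ea≡a) ⟩
        (e * a) * u  ≡⟨ solve 3 (λ e a u → (e :* a) :* u := a :* (e :* u)) refl e a u ⟩
        a * (e * u)  ≡⟨ cong (a *_) eu≡0 ⟩
        a * 0#       ≡⟨ zeroʳ a ⟩
        0#           ∎
      u≢a : u ≢ a
      u≢a refl = a≢0 (trans (sym ea≡a) eu≡0)
    w = b + f
    ew≡b : e * w ≡ b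
    ew≡b = trans (distribˡ e b f) (trans (cong₂ _+_ eb≡b e*f≡0) (+-identityʳ b))
    fa≡0 : f * a ≡ 0#
    fa≡0 = e*x≡x⇒f*x≡0 ea≡a
    w≢0 : w ≢ 0#
    w≢0 w≡0 = b≢0 (trans (sym ew≡b) (trans (cong (e *_) w≡0) (zeroʳ e)))
    w≢a : w ≢ a
    w≢a w≡a = f≢0 (+-identityʳ-unique b f (trans w≡a a≡b))
      where
      a≡b : a ≡ b
      a≡b = trans (sym ea≡a) (trans (cong (e *_) (sym w≡a)) ew≡b)
    a~w : Nbr (Γ R) a w
    a~w = ((a , a≢0 , trans (distribʳ a b f) (trans (cong₂ _+_ (trans (*-comm b a) ab≡0) fa≡0) (+-identityʳ 0#))) , w≢0)
          , w≢a , w≢a ∘ sym , trans (distribˡ a b f) (trans (cong₂ _+_ ab≡0 (trans (*-comm a f) fa≡0)) (+-identityʳ 0#))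
    e≁w : ¬ Nbr (Γ R) e w
    e≁w (_ , _ , _ , ew≡0) = b≢0 (trans (sym ew≡b) ew≡0)

  module Sides (s : Splitting) where
    open Splitting s

    e-side? : ∀ x → Dec (f * x ≡ 0# × x ≢ 0#)
    e-side? x = (f * x ≟ 0#) ×-dec ¬? (x ≟ 0#)

    -- the nonzero elements of eR
    Eˣ : List Carrier
    Eˣ = enumerate e-side?

    Eˣ-vertex : ∀ {x} → x ∈ Eˣ → Vertex x
    Eˣ-vertex x∈Eˣ with fx≡0 , x≢0 ← ∈-enumerate⁻ e-side? x∈Eˣ = (f , f≢0 , trans (*-comm _ f) fx≡0) , x≢0

    ∈Eˣ⇔f~ : ∀ {u} → u ∈ Eˣ ⇔ Nbr (Γ R) f u
    ∈Eˣ⇔f~ {u} = mk⇔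
      (λ u∈Eˣ → let fu≡0 , u≢0 = ∈-enumerate⁻ e-side? u∈Eˣ
                    u≢f : u ≢ f
                    u≢f u≡f = f≢0 (trans (sym f*f≡f) (trans (cong (f *_) (sym u≡f)) fu≡0))
                in Eˣ-vertex u∈Eˣ , u≢f , u≢f ∘ sym , fu≡0)
      (λ (u∈V , _ , _ , fu≡0) → ∈-enumerate⁺ e-side? (fu≡0 , proj₂ u∈V))

    regular⇒|Eˣ|≡degree : ∀ {r} → IsRegular (Γ R) r → length Eˣ ≡ r
    regular⇒|Eˣ|≡degree reg = HasSize⇒length≡ (reg f ((e , e≢0 , trans (*-comm f e) e*f≡0) , f≢0)) (enumerate-unique e-side?) ∈Eˣ⇔f~

  module Bipartition (s : Splitting) (e-domain : NoZeroDivisorsIn (Splitting.e s))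
                     (f-domain : NoZeroDivisorsIn (Splitting.f s)) where
    open Splitting s
    open Sides s
    open Sides (swap s) using () renaming (e-side? to f-side?; Eˣ to Fˣ; Eˣ-vertex to Fˣ-vertex)

    -- If z y = 0 with y ≠ 0, then either e y ≠ 0, and e z ≠ 0 would give zero-divisors e z, e y in eR;
    -- or f y = y ≠ 0, and likewise f z = 0.
    classify : ∀ {z} → Vertex z → z ∈ Eˣ ⊎ z ∈ Fˣ
    classify {z} ((y , y≢0 , zy≡0) , z≢0) with e * y ≟ 0#
    ... | no ey≢0 with e * z ≟ 0#
    ...   | yes ez≡0 = inj₂ (∈-enumerate⁺ f-side? (ez≡0 , z≢0))
    ...   | no ez≢0  = ⊥-elim (e-domain (e*[e*x]≡e*x z) (e*[e*x]≡e*x y) ez≢0 ey≢0 (x*y≡0⇒[g*x]*[g*y]≡0 e zy≡0))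
    classify {z} ((y , y≢0 , zy≡0) , z≢0) | yes ey≡0 with f * z ≟ 0#
    ...   | yes fz≡0 = inj₁ (∈-enumerate⁺ e-side? (fz≡0 , z≢0))
    ...   | no fz≢0  = ⊥-elim (f-domain (f*[f*x]≡f*x z) (f*[f*x]≡f*x y) fz≢0 (y≢0 ∘ trans (sym (e*x≡0⇒f*x≡x ey≡0))) (x*y≡0⇒[g*x]*[g*y]≡0 f zy≡0))

    private
      e-component : ∀ {x} → x ∈ Eˣ → e * x ≡ x × x ≢ 0#
      e-component x∈Eˣ with fx≡0 , x≢0 ← ∈-enumerate⁻ e-side? x∈Eˣ = f*x≡0⇒e*x≡x fx≡0 , x≢0
      f-component : ∀ {x} → x ∈ Fˣ → f * x ≡ x × x ≢ 0#
      f-component x∈Fˣ with ex≡0 , x≢0 ← ∈-enumerate⁻ f-side? x∈Fˣ = e*x≡0⇒f*x≡x ex≡0 , x≢0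

      Eˣ-independent : ∀ {x y} → x ∈ Eˣ → y ∈ Eˣ → ¬ Adj (Γ R) x y
      Eˣ-independent x∈Eˣ y∈Eˣ (_ , xy≡0) with ex≡x , x≢0 ← e-component x∈Eˣ | ey≡y , y≢0 ← e-component y∈Eˣ =
        e-domain ex≡x ey≡y x≢0 y≢0 xy≡0
      Fˣ-independent : ∀ {x y} → x ∈ Fˣ → y ∈ Fˣ → ¬ Adj (Γ R) x y
      Fˣ-independent x∈Fˣ y∈Fˣ (_ , xy≡0) with fx≡x , x≢0 ← f-component x∈Fˣ | fy≡y , y≢0 ← f-component y∈Fˣ =
        f-domain fx≡x fy≡y x≢0 y≢0 xy≡0

      cross : ∀ {x y} → x ∈ Eˣ → y ∈ Fˣ → Adj (Γ R) x y × Adj (Γ R) y x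
      cross x∈Eˣ y∈Fˣ with ex≡x , _ ← e-component x∈Eˣ | fy≡y , y≢0 ← f-component y∈Fˣ =
        (x≢y , xy≡0) , (x≢y ∘ sym , trans (*-comm _ _) xy≡0)
        where
        xy≡0 = e*x≡x∧f*y≡y⇒x*y≡0 ex≡x fy≡y
        x≢y : _ ≢ _
        x≢y refl = y≢0 (trans (sym fy≡y) (e*x≡x⇒f*x≡0 ex≡x))

    open CompleteBipartite (Γ R) (enumerate-unique e-side?) (enumerate-unique f-side?) Eˣ-vertex Fˣ-vertex
      classify Eˣ-independent Fˣ-independent cross public

  regular⇒independenceNumber : 1# ≢ 0# → ¬ IsIntegralDomain R → ∀ r → IsRegular (Γ R) r →
    IndependenceNumberIs (Γ R) 1 ⊎ IndependenceNumberIs (Γ R) r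
  regular⇒independenceNumber 1≢0 ¬domain r reg with splitting⊎local
  ... | inj₂ local = inj₁ (complete⇒independenceNumber≡1 (Γ R) vertex (local∧regular⇒complete local reg vertex))
    where vertex = vertex-exists 1≢0 ¬domain
  ... | inj₁ s = inj₂ (subst (IndependenceNumberIs (Γ R)) |Eˣ|≡r (independenceNumber (ℕ.≤-reflexive (trans |Fˣ|≡r (sym |Eˣ|≡r)))))
    where
    open Bipartition s (regular⇒no-zero-divisors reg s) (regular⇒no-zero-divisors reg (swap s))
    |Eˣ|≡r = Sides.regular⇒|Eˣ|≡degree s reg
    |Fˣ|≡r = Sides.regular⇒|Eˣ|≡degree (swap s) reg

  -- Zᴱ: the zero-divisors of the ring eR (including 0); Uᴱ: its units.
  module Components (s : Splitting) where
    open Splitting s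
    open Sides s public

    Zᴱ-member? : ∀ x → Dec (f * x ≡ 0# × Σ[ y ∈ Carrier ] (f * y ≡ 0# × y ≢ 0# × x * y ≡ 0#))
    Zᴱ-member? x = (f * x ≟ 0#) ×-dec any? (λ y → (f * y ≟ 0#) ×-dec ¬? (y ≟ 0#) ×-dec (x * y ≟ 0#))

    Uᴱ-member? : ∀ x → Dec (f * x ≡ 0# × Σ[ y ∈ Carrier ] x * y ≡ e)
    Uᴱ-member? x = (f * x ≟ 0#) ×-dec any? (λ y → x * y ≟ e)

    Zᴱ Uᴱ : List Carrier
    Zᴱ = enumerate Zᴱ-member?
    Uᴱ = enumerate Uᴱ-member?

    0∈Zᴱ : 0# ∈ Zᴱ
    0∈Zᴱ = ∈-enumerate⁺ Zᴱ-member? (zeroʳ f , e , f*e≡0 , e≢0 , zeroˡ e)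
      where f*e≡0 = trans (*-comm f e) e*f≡0

    e∈Uᴱ : e ∈ Uᴱ
    e∈Uᴱ = ∈-enumerate⁺ Uᴱ-member? (trans (*-comm f e) e*f≡0 , e , e*e≡e)

    -- x ∈ eR is a unit or a zero-divisor of eR according as x + f is a unit or a zero-divisor of R.
    e-zero-divisor⊎e-unit : ∀ {x} → f * x ≡ 0# → x ∈ Zᴱ ⊎ x ∈ Uᴱ
    e-zero-divisor⊎e-unit {x} fx≡0 with Zᴱ-member? x
    ... | yes x∈Zᴱ = inj₁ (∈-enumerate⁺ Zᴱ-member? x∈Zᴱ)
    ... | no x∉Zᴱ = inj₂ (∈-enumerate⁺ Uᴱ-member? (fx≡0 , e * w , (begin
        x * (e * w)       ≡⟨ solve 3 (λ x e w → x :* (e :* w) := (e :* x) :* w) refl x e w ⟩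
        (e * x) * w       ≡⟨ cong (_* w) (sym e[x+f]≡x) ⟩
        (e * (x + f)) * w ≡⟨ *-assoc e (x + f) w ⟩
        e * ((x + f) * w) ≡⟨ cong (e *_) (proj₂ x+f-unit) ⟩
        e * 1#            ≡⟨ *-identityʳ e ⟩
        e                 ∎)))
      where
      e[x+f]≡x : e * (x + f) ≡ e * x
      e[x+f]≡x = trans (distribˡ e x f) (trans (cong (e * x +_) e*f≡0) (+-identityʳ _))
      f[x+f]≡f : f * (x + f) ≡ f
      f[x+f]≡f = trans (distribˡ f x f) (trans (cong₂ _+_ fx≡0 f*f≡f) (+-identityˡ f))
      x+f-cancel : ∀ w → (x + f) * w ≡ 0# → w ≡ 0#
      x+f-cancel w [x+f]w≡0 with w ≟ 0#
      ... | yes w≡0 = w≡0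
      ... | no w≢0  = ⊥-elim (x∉Zᴱ (fx≡0 , w , fw≡0 , w≢0 , xw≡0))
        where
        kills : ∀ g → g * (x + f) * w ≡ 0#
        kills g = trans (*-assoc g (x + f) w) (trans (cong (g *_) [x+f]w≡0) (zeroʳ g))
        fw≡0 : f * w ≡ 0#
        fw≡0 = trans (cong (_* w) (sym f[x+f]≡f)) (kills f)
        xw≡0 : x * w ≡ 0#
        xw≡0 = trans (cong (_* w) (trans (sym (f*x≡0⇒e*x≡x fx≡0)) (sym e[x+f]≡x))) (kills e)
      x+f-unit = non-zero-divisor⇒unit x+f-cancel
      w = proj₁ x+f-unit

    |Eˣ|<|Zᴱ|+|Uᴱ| : length Eˣ ℕ.< length Zᴱ ℕ.+ length Uᴱ
    |Eˣ|<|Zᴱ|+|Uᴱ| = subst (length Eˣ ℕ.<_) (length-++ Zᴱ)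
      (Unique-⊆⇒length≤ (Unique-∷ (λ 0∈Eˣ → proj₂ (∈-enumerate⁻ e-side? 0∈Eˣ) refl) (enumerate-unique e-side?)) 0∷Eˣ⊆Zᴱ++Uᴱ)
      where
      0∷Eˣ⊆Zᴱ++Uᴱ : 0# ∷ Eˣ ⊆ Zᴱ ++ Uᴱ
      0∷Eˣ⊆Zᴱ++Uᴱ (here refl) = ∈-++⁺ˡ 0∈Zᴱ
      0∷Eˣ⊆Zᴱ++Uᴱ (there x∈Eˣ) = Sum.[ ∈-++⁺ˡ , ∈-++⁺ʳ Zᴱ ]′ (e-zero-divisor⊎e-unit (proj₁ (∈-enumerate⁻ e-side? x∈Eˣ)))

  module _ (ham : IsHamiltonian (Γ R)) (s : Splitting) where
    open Splitting s
    open Components s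
    open Components (swap s) using () renaming (Uᴱ to Uᶠ; Uᴱ-member? to Uᶠ-member?)

    -- x + u, with x a zero-divisor of eR and u a unit of fR, is a vertex all of whose neighbours lie in eR.
    hamiltonian⇒|Zᴱ|*|Uᶠ|≤|Eˣ| : length Zᴱ ℕ.* length Uᶠ ℕ.≤ length Eˣ
    hamiltonian⇒|Zᴱ|*|Uᶠ|≤|Eˣ| = subst (ℕ._≤ length Eˣ) (length-cartesianProductWith _+_ Zᴱ Uᶠ)
      (hamiltonian⇒length≤neighbours (Γ R) ham S! S⊆V N[S]⊆Eˣ)
      where
      S = cartesianProductWith _+_ Zᴱ Uᶠ
      e[x+u]≡x : ∀ {x u} → f * x ≡ 0# → e * u ≡ 0# → e * (x + u) ≡ x
      e[x+u]≡x fx≡0 eu≡0 = trans (distribˡ e _ _) (trans (cong₂ _+_ (f*x≡0⇒e*x≡x fx≡0) eu≡0) (+-identityʳ _))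
      f[x+u]≡u : ∀ {x u} → f * x ≡ 0# → e * u ≡ 0# → f * (x + u) ≡ u
      f[x+u]≡u fx≡0 eu≡0 = trans (distribˡ f _ _) (trans (cong₂ _+_ fx≡0 (e*x≡0⇒f*x≡x eu≡0)) (+-identityˡ _))
      S! : Unique S
      S! = Unique-cartesianProductWith _+_ (enumerate-unique Zᴱ-member?) (enumerate-unique Uᶠ-member?) injective
        where
        injective : ∀ {x x′ u u′} → x ∈ Zᴱ → x′ ∈ Zᴱ → u ∈ Uᶠ → u′ ∈ Uᶠ → x + u ≡ x′ + u′ → x ≡ x′ × u ≡ u′
        injective x∈ x′∈ u∈ u′∈ eq
          with fx≡0 , _ ← ∈-enumerate⁻ Zᴱ-member? x∈ | fx′≡0 , _ ← ∈-enumerate⁻ Zᴱ-member? x′∈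
             | eu≡0 , _ ← ∈-enumerate⁻ Uᶠ-member? u∈ | eu′≡0 , _ ← ∈-enumerate⁻ Uᶠ-member? u′∈ =
          trans (sym (e[x+u]≡x fx≡0 eu≡0)) (trans (cong (e *_) eq) (e[x+u]≡x fx′≡0 eu′≡0)) ,
          trans (sym (f[x+u]≡u fx≡0 eu≡0)) (trans (cong (f *_) eq) (f[x+u]≡u fx′≡0 eu′≡0))
      S⊆V : ∀ {v} → v ∈ S → Vertex v
      S⊆V v∈S with x , u , x∈ , u∈ , refl ← ∈-cartesianProductWith⁻ _+_ Zᴱ Uᶠ v∈S
        with fx≡0 , y , fy≡0 , y≢0 , xy≡0 ← ∈-enumerate⁻ Zᴱ-member? x∈ | eu≡0 , u′ , uu′≡f ← ∈-enumerate⁻ Uᶠ-member? u∈ =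
        (y , y≢0 , [x+u]y≡0) , x+u≢0
        where
        uy≡0 : u * y ≡ 0#
        uy≡0 = trans (*-comm u y) (e*x≡x∧f*y≡y⇒x*y≡0 (f*x≡0⇒e*x≡x fy≡0) (e*x≡0⇒f*x≡x eu≡0))
        [x+u]y≡0 : (x + u) * y ≡ 0#
        [x+u]y≡0 = trans (distribʳ y x u) (trans (cong₂ _+_ xy≡0 uy≡0) (+-identityˡ 0#))
        x+u≢0 : x + u ≢ 0#
        x+u≢0 x+u≡0 = f≢0 (begin
          f              ≡⟨ sym uu′≡f ⟩
          u * u′         ≡⟨ cong (_* u′) (sym (f[x+u]≡u fx≡0 eu≡0)) ⟩
          f * (x + u) * u′ ≡⟨ cong (λ z → f * z * u′) x+u≡0 ⟩
          f * 0# * u′    ≡⟨ cong (_* u′) (zeroʳ f) ⟩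
          0# * u′        ≡⟨ zeroˡ u′ ⟩
          0#             ∎)
      N[S]⊆Eˣ : ∀ {v w} → v ∈ S → Vertex w → Adj (Γ R) v w → w ∈ Eˣ
      N[S]⊆Eˣ v∈S (_ , w≢0) (_ , vw≡0) with x , u , x∈ , u∈ , refl ← ∈-cartesianProductWith⁻ _+_ Zᴱ Uᶠ v∈S
        with fx≡0 , _ ← ∈-enumerate⁻ Zᴱ-member? x∈ | eu≡0 , u′ , uu′≡f ← ∈-enumerate⁻ Uᶠ-member? u∈ =
        ∈-enumerate⁺ e-side? (fw≡0 , w≢0)
        where
        w = _
        uw≡0 : u * w ≡ 0#
        uw≡0 = trans (cong (_* w) (sym (f[x+u]≡u fx≡0 eu≡0))) (trans (*-assoc f (x + u) w) (trans (cong (f *_) vw≡0) (zeroʳ f)))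
        fw≡0 : f * w ≡ 0#
        fw≡0 = begin
          f * w          ≡⟨ cong (_* w) (sym uu′≡f) ⟩
          (u * u′) * w   ≡⟨ solve 3 (λ u u′ w → (u :* u′) :* w := u′ :* (u :* w)) refl u u′ w ⟩
          u′ * (u * w)   ≡⟨ cong (u′ *_) uw≡0 ⟩
          u′ * 0#        ≡⟨ zeroʳ u′ ⟩
          0#             ∎

  atom-complement⇒neighbour≡atom : ∀ {a h} → (∀ z → z * a ≡ 0# ⊎ z * a ≡ a) → a + h ≡ 1# →
    ∀ {w} → Vertex w → h * w ≡ 0# → w ≡ a
  atom-complement⇒neighbour≡atom {a} {h} atom a+h≡1 {w} (_ , w≢0) hw≡0 = Sum.[
      (λ wa≡0 → ⊥-elim (w≢0 (trans w≡aw (trans (*-comm a w) wa≡0)))) ,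
      (λ wa≡a → trans w≡aw (trans (*-comm a w) wa≡a)) ]′ (atom w)
    where
    w≡aw : w ≡ a * w
    w≡aw = begin
      w              ≡⟨ sym (*-identityˡ w) ⟩
      1# * w         ≡⟨ cong (_* w) (sym a+h≡1) ⟩
      (a + h) * w    ≡⟨ distribʳ w a h ⟩
      a * w + h * w  ≡⟨ cong (a * w +_) hw≡0 ⟩
      a * w + 0#     ≡⟨ +-identityʳ _ ⟩
      a * w          ∎

  -- Γ(𝔽₂ⁿ) with n ≥ 2: the complement of an atom is a vertex of degree one.
  boolean∧splitting⇒¬hamiltonian : (∀ x → x * x ≡ x) → Splitting → ¬ IsHamiltonian (Γ R)
  boolean∧splitting⇒¬hamiltonian boolean s ham =
    let a , a≢0 , ae≡a , atom = boolean⇒atom-below boolean e≢0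
        h , a+h≡1 , ah≡0 , _  = idempotent⇒complement (boolean a)
        h≢0 : h ≢ 0#
        h≢0 h≡0 = f≢0 (+-identityʳ-unique 1# f (trans (cong (_+ f) (sym (e≡1 a+h≡1 h≡0 ae≡a))) e+f≡1))
        u , w , u∈V , w∈V , u≢w , (_ , uh≡0) , (_ , hw≡0) =
          hamiltonian⇒distinct-neighbours (Γ R) ham ((a , a≢0 , trans (*-comm h a) ah≡0) , h≢0)
    in u≢w (trans (atom-complement⇒neighbour≡atom atom a+h≡1 u∈V (trans (*-comm h u) uh≡0))
             (sym (atom-complement⇒neighbour≡atom atom a+h≡1 w∈V hw≡0)))
    where
    open Splitting s
    e≡1 : ∀ {a h} → a + h ≡ 1# → h ≡ 0# → a * e ≡ a → e ≡ 1#
    e≡1 {a} a+h≡1 h≡0 ae≡a = trans (sym (*-identityˡ e)) (trans (cong (_* e) (sym a≡1)) (trans ae≡a a≡1))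
      where a≡1 = trans (sym (+-identityʳ a)) (trans (cong (a +_) (sym h≡0)) a+h≡1)

  -- If eR is not a domain, counting vertices of the two kinds above forces eR and fR to have
  -- a single unit each, so R has no units but 1 and is Boolean.
  hamiltonian⇒no-zero-divisors : IsHamiltonian (Γ R) → (s : Splitting) → NoZeroDivisorsIn (Splitting.e s)
  hamiltonian⇒no-zero-divisors ham s {a} {b} ea≡a eb≡b a≢0 b≢0 ab≡0 =
    boolean∧splitting⇒¬hamiltonian (trivial-units⇒boolean units≡1) s ham
    where
    open Splitting s
    open Components s
    open Components (swap s) using () renaming (Zᴱ to Zᶠ; Uᴱ to Uᶠ; 0∈Zᴱ to 0∈Zᶠ; e∈Uᴱ to f∈Uᶠ; Uᴱ-member? to Uᶠ-member?)
    1≤length : ∀ {x} {xs : List Carrier} → x ∈ xs → 1 ℕ.≤ length xs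
    1≤length x∈xs = Unique-⊆⇒length≤ ([] ∷ []) λ { (here refl) → x∈xs ; (there ()) }
    2≤|Zᴱ| : 2 ℕ.≤ length Zᴱ
    2≤|Zᴱ| = Unique-⊆⇒length≤ (Unique-∷ (λ { (here 0≡a) → a≢0 (sym 0≡a) ; (there ()) }) ([] ∷ []))
      λ { (here refl) → 0∈Zᴱ ; (there (here refl)) → ∈-enumerate⁺ Zᴱ-member? (e*x≡x⇒f*x≡0 ea≡a , b , e*x≡x⇒f*x≡0 eb≡b , b≢0 , ab≡0) }
    |Uᴱ|≡1×|Uᶠ|≡1 : length Uᴱ ≡ 1 × length Uᶠ ≡ 1
    |Uᴱ|≡1×|Uᶠ|≡1 = product-bounds⇒≡1 2≤|Zᴱ| (1≤length 0∈Zᶠ) (1≤length e∈Uᴱ) (1≤length f∈Uᶠ)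
      (ℕ.≤-<-trans (hamiltonian⇒|Zᴱ|*|Uᶠ|≤|Eˣ| ham s) |Eˣ|<|Zᴱ|+|Uᴱ|)
      (ℕ.≤-<-trans (hamiltonian⇒|Zᴱ|*|Uᶠ|≤|Eˣ| ham (swap s)) (Components.|Eˣ|<|Zᴱ|+|Uᴱ| (swap s)))
    units≡1 : ∀ u → Unit u → u ≡ 1#
    units≡1 u (u′ , uu′≡1) = begin
      u              ≡⟨ sym (e*x+f*x≡x u) ⟩
      e * u + f * u  ≡⟨ cong₂ _+_ (length≤1⇒∈-≡ (ℕ.≤-reflexive (proj₁ |Uᴱ|≡1×|Uᶠ|≡1)) eu∈Uᴱ e∈Uᴱ)
                                  (length≤1⇒∈-≡ (ℕ.≤-reflexive (proj₂ |Uᴱ|≡1×|Uᶠ|≡1)) fu∈Uᶠ f∈Uᶠ) ⟩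
      e + f          ≡⟨ e+f≡1 ⟩
      1#             ∎
      where
      component-unit : ∀ g → g * g ≡ g → (g * u) * (g * u′) ≡ g
      component-unit g gg≡g = trans (solve 3 (λ g u u′ → (g :* u) :* (g :* u′) := (g :* g) :* (u :* u′)) refl g u u′)
                                    (trans (cong₂ _*_ gg≡g uu′≡1) (*-identityʳ g))
      eu∈Uᴱ : e * u ∈ Uᴱ
      eu∈Uᴱ = ∈-enumerate⁺ Uᴱ-member? (f*[e*x]≡0 u , e * u′ , component-unit e e*e≡e)
      fu∈Uᶠ : f * u ∈ Uᶠ
      fu∈Uᶠ = ∈-enumerate⁺ Uᶠ-member? (e*[f*x]≡0 u , f * u′ , component-unit f f*f≡f)

  decomposable∧hamiltonian⇒independenceNumber : IsDecomposable R → IsHamiltonian (Γ R) →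
    Σ[ k ∈ ℕ ] (IndependenceNumberIs (Γ R) k × HasSize Vertex (2 ℕ.* k))
  decomposable∧hamiltonian⇒independenceNumber decomposable ham =
    length Eˣ , independenceNumber (ℕ.≤-reflexive |Fˣ|≡|Eˣ|) ,
    subst (HasSize Vertex) (cong (length Eˣ ℕ.+_) (trans |Fˣ|≡|Eˣ| (sym (ℕ.+-identityʳ _)))) vertex-count
    where
    s = decomposable⇒splitting decomposable
    e-domain = hamiltonian⇒no-zero-divisors ham s
    f-domain = hamiltonian⇒no-zero-divisors ham (swap s)
    open Bipartition s e-domain f-domain
    open Sides s using (Eˣ)
    |Fˣ|≡|Eˣ| : length (Sides.Eˣ (swap s)) ≡ length Eˣ
    |Fˣ|≡|Eˣ| = ℕ.≤-antisym (Bipartition.hamiltonian⇒length≤ (swap s) f-domain e-domain ham) (hamiltonian⇒length≤ ham)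

  local⇒nilradical-ideal : 1# ≢ 0# → IsLocal → IsIdeal R IsNilpotent
  local⇒nilradical-ideal 1≢0 local = record
    { zero∈ = 1 , zeroˡ 1#
    ; +-closed = +-closed
    ; neg-closed = λ _ → nilpotent-neg
    ; *-closed = λ r _ → nilpotent-*ˡ r }
    where
    -- if (x + y) w = 1 then y w = 1 - w x is both a unit and nilpotent
    +-closed : ∀ x y → IsNilpotent x → IsNilpotent y → IsNilpotent (x + y)
    +-closed x y x-nil y-nil with local⇒unit⊎nilpotent local (x + y)
    ... | inj₂ x+y-nil = x+y-nil
    ... | inj₁ (w , [x+y]w≡1) = ⊥-elim (1≢0 (unit∧nilpotent⇒1≡0 yw-unit yw-nil))
      where
      yw-nil : IsNilpotent (y * w)
      yw-nil = subst IsNilpotent (*-comm w y) (nilpotent-*ˡ w y-nil)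
      yw≡1-wx : y * w ≡ 1# + - (w * x)
      yw≡1-wx = +-cancelˡ (x * w) _ _ (begin
        x * w + y * w              ≡⟨ sym (distribʳ w x y) ⟩
        (x + y) * w                ≡⟨ [x+y]w≡1 ⟩
        1#                         ≡⟨ sym (+-identityˡ 1#) ⟩
        0# + 1#                    ≡⟨ cong (_+ 1#) (sym (-‿inverseʳ (w * x))) ⟩
        (w * x + - (w * x)) + 1#   ≡⟨ solve 2 (λ p q → (p :+ q) :+ con 1 := p :+ (con 1 :+ q)) refl (w * x) (- (w * x)) ⟩
        w * x + (1# + - (w * x))   ≡⟨ cong (_+ (1# + - (w * x))) (*-comm w x) ⟩
        x * w + (1# + - (w * x))   ∎)
      yw-unit : Unit (y * w)
      yw-unit = subst Unit (sym yw≡1-wx) (1+nilpotent⇒unit (nilpotent-neg (nilpotent-*ˡ w x-nil)))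

  module PrincipalNilradical (local : IsLocal) {a : Carrier} (a-nilpotent : IsNilpotent a)
    (generated : ∀ {x} → IsNilpotent x → Σ[ r ∈ Carrier ] x ≡ r * a) where

    vertex⇒multiple : ∀ {x} → Vertex x → Σ[ r ∈ Carrier ] x ≡ r * a
    vertex⇒multiple = generated ∘ local⇒zero-divisor⇒nilpotent local ∘ proj₁

    a²≡0⇒complete : a * a ≡ 0# → ∀ {x y} → Vertex x → Vertex y → x ≢ y → Adj (Γ R) x y
    a²≡0⇒complete a²≡0 x∈V y∈V x≢y with vertex⇒multiple x∈V | vertex⇒multiple y∈V
    ... | r , refl | t , refl = x≢y , (begin
      (r * a) * (t * a)  ≡⟨ solve 3 (λ r t a → (r :* a) :* (t :* a) := (r :* t) :* (a :* a)) refl r t a ⟩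
      (r * t) * (a * a)  ≡⟨ cong ((r * t) *_) a²≡0 ⟩
      (r * t) * 0#       ≡⟨ zeroʳ _ ⟩
      0#                 ∎)

    -- Every a + z with a z = 0 equals (1 + ρ) a for a unit 1 + ρ; so these |ann(a)| vertices have all
    -- their neighbours in ann(a) ∖ {0}, which is too small for a Hamiltonian cycle.
    a²≢0⇒¬hamiltonian : a ≢ 0# → a * a ≢ 0# → ¬ IsHamiltonian (Γ R)
    a²≢0⇒¬hamiltonian a≢0 a²≢0 ham = ℕ.<-irrefl refl (ℕ.<-≤-trans |Ann×|<|Ann| (subst (ℕ._≤ length Ann×) (length-map (a +_) Ann) |S|≤|Ann×|))
      where
      ann? : ∀ z → Dec (a * z ≡ 0#)
      ann? z = a * z ≟ 0#
      ann×? : ∀ z → Dec (a * z ≡ 0# × z ≢ 0#)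
      ann×? z = ann? z ×-dec ¬? (z ≟ 0#)
      Ann Ann× : List Carrier
      Ann  = enumerate ann?
      Ann× = enumerate ann×?

      b-witness = annihilator-descent a a≢0 (proj₁ a-nilpotent) (trans (cong (a *_) (proj₂ a-nilpotent)) (zeroʳ a))
      b = a * proj₁ b-witness
      b≢0 : b ≢ 0#
      b≢0 = proj₁ (proj₂ b-witness)
      ab≡0 : a * b ≡ 0#
      ab≡0 = trans (*-comm a b) (proj₂ (proj₂ b-witness))

      unit-multiple : ∀ {z} → a * z ≡ 0# → Σ[ u ∈ Carrier ] (Unit u × a + z ≡ u * a)
      unit-multiple {z} az≡0 with z ≟ 0#
      ... | yes refl = 1# , (1# , *-identityʳ 1#) , trans (+-identityʳ a) (sym (*-identityˡ a))
      ... | no z≢0 with ρ , z≡ρa ← vertex⇒multiple ((a , a≢0 , trans (*-comm z a) az≡0) , z≢0)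
                   with local⇒unit⊎nilpotent local ρ
      ...   | inj₁ ρ-unit = ⊥-elim (a²≢0 (unit⇒x*y≡0⇒y≡0 ρ-unit (begin
              ρ * (a * a)  ≡⟨ solve 2 (λ ρ a → ρ :* (a :* a) := a :* (ρ :* a)) refl ρ a ⟩
              a * (ρ * a)  ≡⟨ cong (a *_) (sym z≡ρa) ⟩
              a * z        ≡⟨ az≡0 ⟩
              0#           ∎)))
      ...   | inj₂ ρ-nil = 1# + ρ , 1+nilpotent⇒unit ρ-nil , (begin
              a + z        ≡⟨ cong (a +_) z≡ρa ⟩
              a + ρ * a    ≡⟨ solve 2 (λ ρ a → a :+ ρ :* a := (con 1 :+ ρ) :* a) refl ρ a ⟩
              (1# + ρ) * a ∎)

      S = map (a +_) Ann

      S⊆V : ∀ {v} → v ∈ S → Vertex v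
      S⊆V v∈S with z , z∈Ann , refl ← ∈-map⁻ (a +_) v∈S
        with u , u-unit , a+z≡ua ← unit-multiple (∈-enumerate⁻ ann? z∈Ann) =
        (b , b≢0 , trans (cong (_* b) a+z≡ua) (trans (*-assoc u a b) (trans (cong (u *_) ab≡0) (zeroʳ u)))) ,
        (λ a+z≡0 → a≢0 (unit⇒x*y≡0⇒y≡0 u-unit (trans (sym a+z≡ua) a+z≡0)))

      N[S]⊆Ann× : ∀ {v w} → v ∈ S → Vertex w → Adj (Γ R) v w → w ∈ Ann×
      N[S]⊆Ann× v∈S (_ , w≢0) (_ , vw≡0) with z , z∈Ann , refl ← ∈-map⁻ (a +_) v∈S
        with u , u-unit , a+z≡ua ← unit-multiple (∈-enumerate⁻ ann? z∈Ann) =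
        ∈-enumerate⁺ ann×? (unit⇒x*y≡0⇒y≡0 u-unit (trans (sym (*-assoc u a _)) (trans (cong (_* _) (sym a+z≡ua)) vw≡0)) , w≢0)

      |S|≤|Ann×| : length S ℕ.≤ length Ann×
      |S|≤|Ann×| = hamiltonian⇒length≤neighbours (Γ R) ham
        (Unique.map⁺ (+-cancelˡ a _ _) (enumerate-unique ann?)) S⊆V N[S]⊆Ann×

      |Ann×|<|Ann| : length Ann× ℕ.< length Ann
      |Ann×|<|Ann| = Unique-⊆⇒length≤ (Unique-∷ (λ 0∈Ann× → proj₂ (∈-enumerate⁻ ann×? 0∈Ann×) refl) (enumerate-unique ann×?))
        λ { (here refl) → ∈-enumerate⁺ ann? (zeroʳ a) ; (there z∈Ann×) → ∈-enumerate⁺ ann? (proj₁ (∈-enumerate⁻ ann×? z∈Ann×)) }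

    hamiltonian⇒independenceNumber≡1 : Σ[ x ∈ Carrier ] Vertex x → IsHamiltonian (Γ R) → IndependenceNumberIs (Γ R) 1
    hamiltonian⇒independenceNumber≡1 vertex ham with a * a ≟ 0#
    ... | yes a²≡0 = complete⇒independenceNumber≡1 (Γ R) vertex (a²≡0⇒complete a²≡0)
    ... | no a²≢0  = ⊥-elim (a²≢0⇒¬hamiltonian a≢0 a²≢0 ham)
      where
      a≢0 : a ≢ 0#
      a≢0 a≡0 = let x , x∈V = vertex
                    r , x≡ra = vertex⇒multiple x∈V
                in proj₂ x∈V (trans x≡ra (trans (cong (r *_) a≡0) (zeroʳ r)))

  principal∧indecomposable∧hamiltonian⇒independenceNumber≡1 : 1# ≢ 0# → ¬ IsIntegralDomain R →
    IsPrincipalIdealRing R → ¬ IsDecomposable R → IsHamiltonian (Γ R) → IndependenceNumberIs (Γ R) 1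
  principal∧indecomposable∧hamiltonian⇒independenceNumber≡1 1≢0 ¬domain principal indecomposable ham
    with splitting⊎local
  ... | inj₁ s     = ⊥-elim (indecomposable (splitting⇒decomposable s))
  ... | inj₂ local with a , generator ← principal IsNilpotent (local⇒nilradical-ideal 1≢0 local) =
    PrincipalNilradical.hamiltonian⇒independenceNumber≡1 local (from (generator a) (1# , sym (*-identityˡ a)))
      (to (generator _)) (vertex-exists 1≢0 ¬domain) ham

open FinCommRing using (0#; 1#)
open import Data.Nat using (_*_)

theorem6 : (R : FinCommRing) → 1# R ≢ 0# R → ¬ IsIntegralDomain R →
    ((r : ℕ) → IsRegular (Γ R) r →
        IndependenceNumberIs (Γ R) 1 ⊎ IndependenceNumberIs (Γ R) r)
    × (IsDecomposable R → IsHamiltonian (Γ R) →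
        Σ[ k ∈ ℕ ] (IndependenceNumberIs (Γ R) k × HasSize (IsZeroDivisorStar R) (2 * k)))
    × (IsPrincipalIdealRing R → ¬ IsDecomposable R → IsHamiltonian (Γ R) →
        IndependenceNumberIs (Γ R) 1)
theorem6 R 1≢0 ¬domain =
  regular⇒independenceNumber 1≢0 ¬domain ,
  decomposable∧hamiltonian⇒independenceNumber ,
  principal∧indecomposable∧hamiltonian⇒independenceNumber≡1 1≢0 ¬domain
  where open ZeroDivisorGraph R
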